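{- Let $K$ be a $(d-1)$-dimensional cubical complex. Then, as $n\to\infty$, \[ \frac{1}{2^{n(d-1)}}\, h^{(sc)}_{\mathrm{sd}_c^n(K)}(x) \to f_{d-1}(K)\,(x+1)^{d-1} \] coefficientwise. In particular, the short cubical $h$-polynomial of $\mathrm{sd}_c^n(K)$ has positive and unimodal coefficients for all sufficiently large $n$.
   Context: A cubical complex is a finite collection $K$ of polytopes in $\mathbb{R}^n$, each combinatorially isomorphic to a cube $[0,1]^m$, closed under taking faces and such that any two intersect in a common face; $f_j(K)$ is its number of $j$-dimensional faces. For a $(d-1)$-dimensional cubical complex $K$, the short cubical $h$-polynomial is $h^{(sc)}_K(x) = \sum_{j=0}^{d-1} f_j(K)(2x)^j(1-x)^{d-1-j}$. The cubical barycentric subdivision $\mathrm{sd}_c(K)$ is the cubical complex whose vertices are the barycenters of the nonempty faces of $K$ and whose nonempty faces are, for each closed interval $[F,G]$ in the poset of nonempty faces of $K$ ordered by inclusion, the convex hull of the barycenters of the faces in $[F,G]$; it has the same dimension as $K$. Iterates: $\mathrm{sd}_c^0(K)=K$, $\mathrm{sd}_c^n(K)=\mathrm{sd}_c(\mathrm{sd}_c^{n-1}(K))$. A sequence $a_0,\ldots,a_m$ is unimodal if $a_0\le\cdots\le a_k\ge\cdots\ge a_m$ for some $k$. -}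

module Defs where

open import Data.Bool using (Bool; true; false; T; _∧_; not; if_then_else_)
open import Data.Nat as ℕ using (ℕ; zero; suc; _∸_; _≡ᵇ_; _⊔_)
open import Data.Nat.Properties using (m^n≢0)
open import Data.Fin using (Fin; zero; suc; _≟_)
open import Data.Integer as ℤ using (ℤ; +_)
open import Data.Rational as ℚ using (ℚ; _/_)
open import Data.List using (List; []; _∷_; length; lookup; filterᵇ; cartesianProduct; allFin; map; foldr; upTo)
open import Data.Vec as Vec using (Vec)
open import Data.Product using (Σ; ∃; _×_; _,_; proj₁; proj₂)
open import Data.Sum using (_⊎_)
open import Data.Empty using (⊥)
open import Relation.Nullary using (¬_; does)
open import Relation.Binary.PropositionalEquality using (_≡_)
open import Function.Bundles using (_↔_; Inverse)

-- Face posets.  A (finite) complex is represented by its poset of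
-- nonempty faces: faces are Fin size, and  le F G = true  means F ⊆ G.

record FaceRel : Set where
  field
    size : ℕ
    le   : Fin size → Fin size → Bool
open FaceRel public

lt : (R : FaceRel) → Fin (size R) → Fin (size R) → Bool
lt R y x = le R y x ∧ not (does (y ≟ x))

-- rank (= dimension) of a face: length of the longest chain
-- F₀ < F₁ < ... < F_k = x; computed with fuel (fuel = size suffices).
height : (R : FaceRel) → ℕ → Fin (size R) → ℕ
height R zero    x = 0
height R (suc k) x =
  foldr _⊔_ 0 (map (λ y → if lt R y x then suc (height R k y) else 0) (allFin (size R)))

dim : (R : FaceRel) → Fin (size R) → ℕ
dim R x = height R (size R) x

fvec : (R : FaceRel) → ℕ → ℕ
fvec R j = length (filterᵇ (λ x → dim R x ≡ᵇ j) (allFin (size R)))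

-- The faces of sd_c(K) are the closed intervals [F,G] (F ⊆ G) of the face
-- poset of K; the face conv[F,G] is contained in conv[F',G'] iff
-- [F,G] ⊆ [F',G'], i.e. F' ⊆ F and G ⊆ G'.

intervals : (R : FaceRel) → List (Fin (size R) × Fin (size R))
intervals R = filterᵇ (λ p → le R (proj₁ p) (proj₂ p))
                      (cartesianProduct (allFin (size R)) (allFin (size R)))

sdc : FaceRel → FaceRel
sdc R = record
  { size = length (intervals R)
  ; le   = λ a b → le R (proj₁ (lookup (intervals R) b)) (proj₁ (lookup (intervals R) a))
                 ∧ le R (proj₂ (lookup (intervals R) a)) (proj₂ (lookup (intervals R) b))
  }

sdcIter : ℕ → FaceRel → FaceRel
sdcIter zero    R = R
sdcIter (suc n) R = sdc (sdcIter n R)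

-- faces of the cube [0,1]^m : words in {0,1,*}^m, with * encoded as 2
CubeFace : ℕ → Set
CubeFace m = Vec (Fin 3) m

cubeLe : ∀ {m} → CubeFace m → CubeFace m → Set
cubeLe {m} u v = (i : Fin m) → (Vec.lookup v i ≡ suc (suc zero)) ⊎ (Vec.lookup u i ≡ Vec.lookup v i)

IsPartialOrder : FaceRel → Set
IsPartialOrder R =
    (∀ x → T (le R x x))
  × (∀ x y → T (le R x y) → T (le R y x) → x ≡ y)
  × (∀ x y z → T (le R x y) → T (le R y z) → T (le R x z))

Below : (R : FaceRel) → Fin (size R) → Set
Below R G = Σ (Fin (size R)) (λ F → T (le R F G))

FaceIsCube : (R : FaceRel) → Fin (size R) → Set
FaceIsCube R G = ∃ λ m → Σ (Below R G ↔ CubeFace m) λ φ →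
  ∀ (a b : Below R G) →
    (T (le R (proj₁ a) (proj₁ b)) → cubeLe (Inverse.to φ a) (Inverse.to φ b))
  × (cubeLe (Inverse.to φ a) (Inverse.to φ b) → T (le R (proj₁ a) (proj₁ b)))

-- any two faces intersect in a common face (possibly the empty one)
IntersectInFace : FaceRel → Set
IntersectInFace R = ∀ F G →
    (∀ H → T (le R H F) → T (le R H G) → ⊥)
  ⊎ (∃ λ H → T (le R H F) × T (le R H G)
             × (∀ H' → T (le R H' F) → T (le R H' G) → T (le R H' H)))

IsCubicalComplex : FaceRel → Set
IsCubicalComplex R = IsPartialOrder R × (∀ G → FaceIsCube R G) × IntersectInFace R

HasDim : FaceRel → ℕ → Set
HasDim R e = (∃ λ x → dim R x ≡ e) × (∀ x → dim R x ℕ.≤ e)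

-- Polynomials over ℤ as coefficient lists (constant term first).

Poly : Set
Poly = List ℤ

padd : Poly → Poly → Poly
padd []       q        = q
padd p        []       = p
padd (a ∷ p)  (b ∷ q)  = (a ℤ.+ b) ∷ padd p q

pscale : ℤ → Poly → Poly
pscale c p = map (c ℤ.*_) p

pmul : Poly → Poly → Poly
pmul []      q = []
pmul (a ∷ p) q = padd (pscale a q) (+ 0 ∷ pmul p q)

ppow : Poly → ℕ → Poly
ppow p zero    = + 1 ∷ []
ppow p (suc k) = pmul p (ppow p k)

coeff : Poly → ℕ → ℤ
coeff []      i       = + 0
coeff (a ∷ p) zero    = a
coeff (a ∷ p) (suc i) = coeff p i

-- short cubical h-polynomial of a (e)-dimensional complex (e = d-1):
--   Σ_{j=0}^{e} f_j (2x)^j (1-x)^{e-j}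
hsc : FaceRel → ℕ → Poly
hsc R e = foldr padd []
  (map (λ j → pscale (+ fvec R j)
                (pmul (ppow (+ 0 ∷ + 2 ∷ []) j) (ppow (+ 1 ∷ ℤ.- (+ 1) ∷ []) (e ∸ j))))
       (upTo (suc e)))

limitPoly : FaceRel → ℕ → Poly
limitPoly R e = pscale (+ fvec R e) (ppow (+ 1 ∷ + 1 ∷ []) e)

_/2^_ : ℤ → ℕ → ℚ
z /2^ k = _/_ z (2 ℕ.^ k) {{m^n≢0 2 k}}

PositiveUnimodal : Poly → ℕ → Set
PositiveUnimodal p e =
    (∀ i → i ℕ.≤ e → + 0 ℤ.< coeff p i)
  × (∃ λ k → k ℕ.≤ e
      × (∀ i → i ℕ.< k → coeff p i ℤ.≤ coeff p (suc i))
      × (∀ i → k ℕ.≤ i → i ℕ.< e → coeff p (suc i) ℤ.≤ coeff p i))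

module Submission where

-- The key invariant is a *cubical rank* r: in every interval
-- [F,G] there are C(r G - r F, t) faces of rank r F + t, and below G there are
-- C(r G, s) 2^(r G - s) faces of rank s, exactly as for the faces of a cube.  We show
-- that cubical complexes carry a cubical rank (CubicalComplexRank, via the cube words of
-- Cube) and that sd_c preserves it (SubdivisionRank); counting intervals then yields
-- f_j(sd_c K) = Σ_i f_i(K) C(i,j) 2^j.  Pascal's matrix diagonalises this recurrence
-- (ClosedForm), so each coefficient of h^(sc)(sd_c^n K) is an exponential sum
-- Σ_{k ≤ e} α_k 2^(nk) with leading coefficient f_e(K) C(e,i).  Such sums are dominated by
-- their leading term (ExponentialSums), and once the error is below half of 2^(ne),
-- positivity and unimodality pass from the binomial coefficients (Unimodality).

open import Defs
open import Algebra.Bundles using (CommutativeSemiring)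
open import Data.Nat as ℕ using (ℕ)
open import Data.Fin using (Fin)
open import Data.Integer using (ℤ)
open import Relation.Binary.PropositionalEquality using (_≡_)

module FiniteSums {c ℓ} (S : CommutativeSemiring c ℓ) where

  open import Data.Nat as ℕ using (ℕ; zero; suc; _∸_)
  import Data.Nat.Properties as ℕP
  open import Data.Fin using (Fin; toℕ)
  open import Relation.Binary.PropositionalEquality as ≡ using (_≡_; _≢_)
  open import Relation.Nullary using (yes; no)
  open import Data.Product using (_,_)

  open CommutativeSemiring S
  open import Algebra.Properties.Semiring.Sum semiring using (sum)
  open import Algebra.Properties.Semiring.Mult semiring using (_×_; ×-assoc-*; ×-congʳ)
  open import Relation.Binary.Reasoning.Setoid setoid

  Σ< : ℕ → (ℕ → Carrier) → Carrier
  Σ< zero    f = 0#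
  Σ< (suc n) f = Σ< n f + f n

  Σ-cong : ∀ n {f g : ℕ → Carrier} → (∀ i → i ℕ.< n → f i ≈ g i) → Σ< n f ≈ Σ< n g
  Σ-cong zero    h = refl
  Σ-cong (suc n) h = +-cong (Σ-cong n (λ i i<n → h i (ℕP.m<n⇒m<1+n i<n))) (h n ℕP.≤-refl)

  Σ-cong≡ : ∀ n {f g : ℕ → Carrier} → (∀ i → f i ≡ g i) → Σ< n f ≈ Σ< n g
  Σ-cong≡ n h = Σ-cong n (λ i _ → reflexive (h i))

  Σ-zero : ∀ n (f : ℕ → Carrier) → (∀ i → i ℕ.< n → f i ≈ 0#) → Σ< n f ≈ 0#
  Σ-zero zero    f h = refl
  Σ-zero (suc n) f h =
    trans (+-cong (Σ-zero n f (λ i i<n → h i (ℕP.m<n⇒m<1+n i<n))) (h n ℕP.≤-refl)) (+-identityʳ 0#)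

  Σ-+ : ∀ n (f g : ℕ → Carrier) → Σ< n (λ i → f i + g i) ≈ Σ< n f + Σ< n g
  Σ-+ zero    f g = sym (+-identityˡ 0#)
  Σ-+ (suc n) f g = begin
    Σ< n (λ i → f i + g i) + (f n + g n) ≈⟨ +-congʳ (Σ-+ n f g) ⟩
    (Σ< n f + Σ< n g) + (f n + g n)      ≈⟨ +-assoc _ _ _ ⟩
    Σ< n f + (Σ< n g + (f n + g n))      ≈⟨ +-congˡ (sym (+-assoc _ _ _)) ⟩
    Σ< n f + ((Σ< n g + f n) + g n)      ≈⟨ +-congˡ (+-congʳ (+-comm _ _)) ⟩
    Σ< n f + ((f n + Σ< n g) + g n)      ≈⟨ +-congˡ (+-assoc _ _ _) ⟩
    Σ< n f + (f n + (Σ< n g + g n))      ≈⟨ sym (+-assoc _ _ _) ⟩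
    (Σ< n f + f n) + (Σ< n g + g n)      ∎

  Σ-*ˡ : ∀ n (a : Carrier) (f : ℕ → Carrier) → a * Σ< n f ≈ Σ< n (λ i → a * f i)
  Σ-*ˡ zero    a f = zeroʳ a
  Σ-*ˡ (suc n) a f = trans (distribˡ a _ _) (+-congʳ (Σ-*ˡ n a f))

  Σ-*ʳ : ∀ n (a : Carrier) (f : ℕ → Carrier) → Σ< n f * a ≈ Σ< n (λ i → f i * a)
  Σ-*ʳ zero    a f = zeroˡ a
  Σ-*ʳ (suc n) a f = trans (distribʳ a _ _) (+-congʳ (Σ-*ʳ n a f))

  Σ-shift : ∀ n (f : ℕ → Carrier) → Σ< (suc n) f ≈ f 0 + Σ< n (λ i → f (suc i))
  Σ-shift zero    f = trans (+-identityˡ _) (sym (+-identityʳ _))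
  Σ-shift (suc n) f = trans (+-congʳ (Σ-shift n f)) (+-assoc _ _ _)

  Σ-split : ∀ m n (f : ℕ → Carrier) → Σ< (m ℕ.+ n) f ≈ Σ< m f + Σ< n (λ i → f (m ℕ.+ i))
  Σ-split m zero f = begin
    Σ< (m ℕ.+ 0) f ≡⟨ ≡.cong (λ k → Σ< k f) (ℕP.+-identityʳ m) ⟩
    Σ< m f         ≈⟨ sym (+-identityʳ _) ⟩
    Σ< m f + 0#    ∎
  Σ-split m (suc n) f = begin
    Σ< (m ℕ.+ suc n) f                                 ≡⟨ ≡.cong (λ k → Σ< k f) (ℕP.+-suc m n) ⟩
    Σ< (m ℕ.+ n) f + f (m ℕ.+ n)                       ≈⟨ +-congʳ (Σ-split m n f) ⟩
    (Σ< m f + Σ< n (λ i → f (m ℕ.+ i))) + f (m ℕ.+ n) ≈⟨ +-assoc _ _ _ ⟩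
    Σ< m f + Σ< (suc n) (λ i → f (m ℕ.+ i))            ∎

  Σ-swap : ∀ m n (f : ℕ → ℕ → Carrier) →
    Σ< m (λ i → Σ< n (λ j → f i j)) ≈ Σ< n (λ j → Σ< m (λ i → f i j))
  Σ-swap zero    n f = sym (Σ-zero n _ (λ _ _ → refl))
  Σ-swap (suc m) n f = trans (+-congʳ (Σ-swap m n f)) (sym (Σ-+ n _ _))

  Σ-extend : ∀ n m (f : ℕ → Carrier) → n ℕ.≤ m → (∀ i → n ℕ.≤ i → i ℕ.< m → f i ≈ 0#) →
    Σ< m f ≈ Σ< n f
  Σ-extend n m f n≤m h with ℕP.m≤n⇒∃[o]m+o≡n n≤m
  ... | k , ≡.refl = begin
    Σ< (n ℕ.+ k) f                     ≈⟨ Σ-split n k f ⟩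
    Σ< n f + Σ< k (λ i → f (n ℕ.+ i))  ≈⟨ +-congˡ (Σ-zero k _ (λ i i<k → h (n ℕ.+ i) (ℕP.m≤m+n n i) (ℕP.+-monoʳ-< n i<k))) ⟩
    Σ< n f + 0#                        ≈⟨ +-identityʳ _ ⟩
    Σ< n f                             ∎

  Σ-delta : ∀ n k (f : ℕ → Carrier) → k ℕ.< n → (∀ i → i ℕ.< n → i ≢ k → f i ≈ 0#) → Σ< n f ≈ f k
  Σ-delta (suc n) k f k<1+n h with k ℕP.≟ n
  ... | yes ≡.refl =
    trans (+-congʳ (Σ-zero n f (λ i i<n → h i (ℕP.m<n⇒m<1+n i<n) (λ i≡n → ℕP.<-irrefl i≡n i<n)))) (+-identityˡ _)
  ... | no k≢n = trans (+-congˡ (h n ℕP.≤-refl (λ n≡k → k≢n (≡.sym n≡k)))) (trans (+-identityʳ _)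
      (Σ-delta n k f (ℕP.≤∧≢⇒< (ℕP.≤-pred k<1+n) k≢n) (λ i i<n → h i (ℕP.m<n⇒m<1+n i<n))))

  Σ-window : ∀ (g : ℕ → Carrier) j i M → j ℕ.≤ i → i ℕ.< M → (∀ k → k ℕ.< j → g k ≈ 0#) →
    (∀ k → i ℕ.< k → k ℕ.< M → g k ≈ 0#) → Σ< M g ≈ Σ< (suc (i ∸ j)) (λ a → g (j ℕ.+ a))
  Σ-window g j i M j≤i i<M below above = begin
    Σ< M g                                           ≈⟨ Σ-extend (suc i) M g i<M above ⟩
    Σ< (suc i) g                                     ≡⟨ ≡.cong (λ z → Σ< z g) (≡.sym width) ⟩
    Σ< (j ℕ.+ suc (i ∸ j)) g                         ≈⟨ Σ-split j (suc (i ∸ j)) g ⟩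
    Σ< j g + Σ< (suc (i ∸ j)) (λ a → g (j ℕ.+ a))    ≈⟨ +-congʳ (Σ-zero j g below) ⟩
    0# + Σ< (suc (i ∸ j)) (λ a → g (j ℕ.+ a))        ≈⟨ +-identityˡ _ ⟩
    Σ< (suc (i ∸ j)) (λ a → g (j ℕ.+ a))             ∎
    where
    width : j ℕ.+ suc (i ∸ j) ≡ suc i
    width = ≡.trans (ℕP.+-suc j (i ∸ j)) (≡.cong suc (ℕP.m+[n∸m]≡n j≤i))

  Σ<≈sum : ∀ n (f : ℕ → Carrier) → Σ< n f ≈ sum (λ (i : Fin n) → f (toℕ i))
  Σ<≈sum zero    f = refl
  Σ<≈sum (suc n) f = trans (Σ-shift n f) (+-congˡ (Σ<≈sum n (λ i → f (suc i))))

  ι : ℕ → Carrier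
  ι m = m × 1#

  ι-scale : ∀ m x → m × x ≈ ι m * x
  ι-scale m x = sym (trans (×-assoc-* m 1# x) (×-congʳ m (*-identityˡ x)))

module Binomial where

  open import Data.Nat as ℕ using (ℕ; zero; suc; _+_; _*_; _∸_; _≤_; _<_; z≤n; s≤s; _!)
  import Data.Nat.Properties as ℕP
  open import Data.Nat.Combinatorics
    using (_C_; nCk+nC[k+1]≡[n+1]C[k+1]; k>n⇒nCk≡0; nCn≡1; nC1≡n; nCk≡nC[n∸k]; nCk≡n!/k![n-k]!; k![n∸k]!∣n!)
  open import Data.Nat.DivMod using (_/_; m/n*n≡m)
  open import Data.Nat.Tactic.RingSolver using (solve-∀)
  open import Relation.Binary.PropositionalEquality as ≡ using (_≡_; refl; sym; trans; cong; cong₂)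
  open import Data.Product using (_,_)
  open import Relation.Nullary using (yes; no)
  open ≡.≡-Reasoning

  open FiniteSums ℕP.+-*-commutativeSemiring renaming (Σ< to Σℕ) public

  bin : ℕ → ℕ → ℕ
  bin n       zero    = 1
  bin zero    (suc k) = 0
  bin (suc n) (suc k) = bin n k + bin n (suc k)

  bin≡C : ∀ n k → bin n k ≡ n C k
  bin≡C n       zero    = refl
  bin≡C zero    (suc k) = refl
  bin≡C (suc n) (suc k) = trans (cong₂ _+_ (bin≡C n k) (bin≡C n (suc k))) (nCk+nC[k+1]≡[n+1]C[k+1] n k)

  bin-> : ∀ n k → n < k → bin n k ≡ 0
  bin-> n k n<k = trans (bin≡C n k) (k>n⇒nCk≡0 n<k)

  bin-nn : ∀ n → bin n n ≡ 1
  bin-nn n = trans (bin≡C n n) (nCn≡1 n)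

  bin-1 : ∀ n → bin n 1 ≡ n
  bin-1 n = trans (bin≡C n 1) (nC1≡n n)

  bin-complement : ∀ {d k} → k ≤ d → bin d (d ∸ k) ≡ bin d k
  bin-complement {d} {k} k≤d = trans (bin≡C d (d ∸ k)) (trans (sym (nCk≡nC[n∸k] k≤d)) (sym (bin≡C d k)))

  bin-sym : ∀ a b → bin (a + b) a ≡ bin (a + b) b
  bin-sym a b = trans (cong (bin (a + b)) (sym (ℕP.m+n∸n≡m a b))) (bin-complement (ℕP.m≤n+m b a))

  bin-factorial : ∀ k l → bin (k + l) k * (k ! * l !) ≡ (k + l) !
  bin-factorial k l = begin
    bin (k + l) k * (k ! * l !)             ≡⟨ cong₂ (λ c m → c * (k ! * m !)) (bin≡C (k + l) k) (sym (ℕP.m+n∸m≡n k l)) ⟩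
    ((k + l) C k) * (k ! * (k + l ∸ k) !)   ≡⟨ cong (_* (k ! * (k + l ∸ k) !)) (nCk≡n!/k![n-k]! k≤k+l) ⟩
    ((k + l) ! / (k ! * (k + l ∸ k) !)) * (k ! * (k + l ∸ k) !) ≡⟨ m/n*n≡m (k![n∸k]!∣n! k≤k+l) ⟩
    (k + l) !                               ∎
    where
    instance _ = ℕP._!*_!≢0 k (k + l ∸ k)
    k≤k+l = ℕP.m≤m+n k l

  -- both sides times j! k! l! are (j + k + l)!: splitting j + k + l objects into blocks of sizes j, k, l
  trinomial-split : ∀ j k l → bin (j + k + l) (j + k) * bin (j + k) j ≡ bin (j + k + l) j * bin (k + l) k
  trinomial-split j k l = ℕP.*-cancelʳ-≡ _ _ (j ! * k ! * l !) {{nonZero}} (trans via-j+k (sym via-j))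
    where
    nonZero = ℕP.m*n≢0 (j ! * k !) (l !) {{ℕP._!*_!≢0 j k}} {{l ℕP.!≢0}}
    regroup₁ : ∀ a b x y z → a * b * (x * y * z) ≡ a * ((b * (x * y)) * z)
    regroup₁ = solve-∀
    regroup₂ : ∀ a b x y z → a * b * (x * y * z) ≡ a * (x * (b * (y * z)))
    regroup₂ = solve-∀
    via-j+k : bin (j + k + l) (j + k) * bin (j + k) j * (j ! * k ! * l !) ≡ (j + k + l) !
    via-j+k = begin
      bin (j + k + l) (j + k) * bin (j + k) j * (j ! * k ! * l !)
        ≡⟨ regroup₁ (bin (j + k + l) (j + k)) (bin (j + k) j) (j !) (k !) (l !) ⟩
      bin (j + k + l) (j + k) * ((bin (j + k) j * (j ! * k !)) * l !)
        ≡⟨ cong (λ z → bin (j + k + l) (j + k) * (z * l !)) (bin-factorial j k) ⟩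
      bin (j + k + l) (j + k) * ((j + k) ! * l !)
        ≡⟨ bin-factorial (j + k) l ⟩
      (j + k + l) ! ∎
    via-j : bin (j + k + l) j * bin (k + l) k * (j ! * k ! * l !) ≡ (j + k + l) !
    via-j = begin
      bin (j + k + l) j * bin (k + l) k * (j ! * k ! * l !)
        ≡⟨ regroup₂ (bin (j + k + l) j) (bin (k + l) k) (j !) (k !) (l !) ⟩
      bin (j + k + l) j * (j ! * (bin (k + l) k * (k ! * l !)))
        ≡⟨ cong (λ z → bin (j + k + l) j * (j ! * z)) (bin-factorial k l) ⟩
      bin (j + k + l) j * (j ! * (k + l) !)
        ≡⟨ cong (λ z → bin z j * (j ! * (k + l) !)) (ℕP.+-assoc j k l) ⟩
      bin (j + (k + l)) j * (j ! * (k + l) !)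
        ≡⟨ bin-factorial j (k + l) ⟩
      (j + (k + l)) !
        ≡⟨ cong _! (ℕP.+-assoc j k l) ⟨
      (j + k + l) ! ∎

  trinomial : ∀ n j k → bin n (j + k) * bin (j + k) j ≡ bin n j * bin (n ∸ j) k
  trinomial n j k with (j + k) ℕP.≤? n
  ... | yes j+k≤n with ℕP.m≤n⇒∃[o]m+o≡n j+k≤n
  ...   | l , refl = trans (trinomial-split j k l) (cong (λ m → bin (j + k + l) j * bin m k) (sym rest))
    where
    rest : j + k + l ∸ j ≡ k + l
    rest = trans (cong (_∸ j) (ℕP.+-assoc j k l)) (ℕP.m+n∸m≡n j (k + l))
  trinomial n j k | no j+k≰n = trans (cong (_* bin (j + k) j) (bin-> n (j + k) (ℕP.≰⇒> j+k≰n))) (sym too-many)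
    where
    too-many : bin n j * bin (n ∸ j) k ≡ 0
    too-many with j ℕP.≤? n
    ... | no j≰n  = cong (_* bin (n ∸ j) k) (bin-> n j (ℕP.≰⇒> j≰n))
    ... | yes j≤n = trans (cong (bin n j *_) (bin-> (n ∸ j) k n∸j<k)) (ℕP.*-zeroʳ (bin n j))
      where
      n∸j<k : n ∸ j < k
      n∸j<k = ℕP.+-cancelˡ-< j (n ∸ j) k (≡.subst (_< j + k) (sym (ℕP.m+[n∸m]≡n j≤n)) (ℕP.≰⇒> j+k≰n))

  absorption : ∀ e i → bin e (suc i) * suc i ≡ bin e i * (e ∸ i)
  absorption e i = begin
    bin e (suc i) * suc i         ≡⟨ cong₂ (λ a b → bin e a * b) (ℕP.+-comm 1 i) (sym C[i+1,i]) ⟩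
    bin e (i + 1) * bin (i + 1) i ≡⟨ trinomial e i 1 ⟩
    bin e i * bin (e ∸ i) 1       ≡⟨ cong (bin e i *_) (bin-1 (e ∸ i)) ⟩
    bin e i * (e ∸ i)             ∎
    where
    C[i+1,i] : bin (i + 1) i ≡ suc i
    C[i+1,i] = trans (bin-sym i 1) (trans (bin-1 (i + 1)) (ℕP.+-comm i 1))

  bin-pos : ∀ e i → i ≤ e → 1 ≤ bin e i
  bin-pos e       zero    _         = s≤s z≤n
  bin-pos (suc e) (suc i) (s≤s i≤e) = ℕP.≤-trans (bin-pos e i i≤e) (ℕP.m≤m+n (bin e i) _)

  bin-increasing : ∀ e i → suc (suc (i + i)) ≤ e → bin e i < bin e (suc i)
  bin-increasing e i 2i+2≤e = ℕP.*-cancelʳ-< (suc i) (bin e i) (bin e (suc i))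
    (≡.subst (bin e i * suc i <_) (sym (absorption e i))
      (ℕP.*-monoʳ-< (bin e i) {{ℕ.>-nonZero (bin-pos e i i≤e)}} i+1<e∸i))
    where
    i≤e : i ≤ e
    i≤e = ℕP.≤-trans (ℕP.≤-trans (ℕP.m≤m+n i i) (ℕP.≤-trans (ℕP.n≤1+n _) (ℕP.n≤1+n _))) 2i+2≤e
    2i+2≡i+[i+2] : suc (suc (i + i)) ≡ i + suc (suc i)
    2i+2≡i+[i+2] = sym (trans (ℕP.+-suc i (suc i)) (cong suc (ℕP.+-suc i i)))
    i+1<e∸i : suc i < e ∸ i
    i+1<e∸i = ≡.subst (_≤ e ∸ i) (ℕP.m+n∸m≡n i (suc (suc i)))
      (ℕP.∸-monoˡ-≤ i (≡.subst (_≤ e) 2i+2≡i+[i+2] 2i+2≤e))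

  bin-decreasing : ∀ e i → e ≤ i + i → i < e → bin e (suc i) < bin e i
  bin-decreasing e i e≤2i i<e = ℕP.*-cancelʳ-< (suc i) (bin e (suc i)) (bin e i)
    (≡.subst (_< bin e i * suc i) (sym (absorption e i))
      (ℕP.≤-<-trans (ℕP.*-monoʳ-≤ (bin e i) e∸i≤i) (ℕP.*-monoʳ-< (bin e i) {{ℕ.>-nonZero (bin-pos e i (ℕP.<⇒≤ i<e))}} (ℕP.n<1+n i))))
    where
    e∸i≤i : e ∸ i ≤ i
    e∸i≤i = ≡.subst (e ∸ i ≤_) (ℕP.m+n∸m≡n i i) (ℕP.∸-monoˡ-≤ i e≤2i)

module BinomialTheorem {c ℓ} (S : CommutativeSemiring c ℓ) where

  open import Data.Nat using (ℕ; suc; _∸_)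
  open import Data.Fin using (toℕ)
  open Binomial using (bin; bin≡C)
  open CommutativeSemiring S
  open FiniteSums S
  open import Algebra.Properties.Semiring.Exp semiring public using (_^_)
  open import Algebra.Properties.Semiring.Mult semiring using (×-congˡ)
  open import Algebra.Properties.Monoid.Sum +-monoid using (sum-cong-≋)
  import Algebra.Properties.CommutativeSemiring.Binomial S as Library

  binomial : ∀ n x y → (x + y) ^ n ≈ Σ< (suc n) (λ k → ι (bin n k) * (x ^ k * y ^ (n ∸ k)))
  binomial n x y = trans (Library.theorem n x y) (sym (trans (Σ<≈sum (suc n) _)
    (sum-cong-≋ {x = λ k → ι (bin n (toℕ k)) * (x ^ toℕ k * y ^ (n ∸ toℕ k))} {y = Library.binomialTerm x y n}
      (λ k → trans (sym (ι-scale (bin n (toℕ k)) _)) (×-congˡ (bin≡C n (toℕ k)))))))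

module BinomialSums where

  open import Data.Nat as ℕ using (ℕ; zero; suc; _+_; _*_; _∸_; _^_; _≤_; _<_; s≤s)
  import Data.Nat.Properties as ℕP
  open import Data.Nat.Tactic.RingSolver using (solve-∀)
  open import Relation.Binary.PropositionalEquality as ≡ using (_≡_; refl; sym; trans; cong; cong₂)
  open import Relation.Nullary using (yes; no)
  open ≡.≡-Reasoning
  open Binomial
  open BinomialTheorem ℕP.+-*-commutativeSemiring using (binomial) renaming (_^_ to _^ₛ_)

  ι≡id : ∀ m → ι m ≡ m
  ι≡id zero    = refl
  ι≡id (suc m) = cong suc (ι≡id m)

  ^ₛ≡^ : ∀ x n → x ^ₛ n ≡ x ^ n
  ^ₛ≡^ x zero    = refl
  ^ₛ≡^ x (suc n) = cong (x *_) (^ₛ≡^ x n)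

  Σbin : ∀ n → Σℕ (suc n) (bin n) ≡ 2 ^ n
  Σbin n = sym (begin
    2 ^ n                                                  ≡⟨ ^ₛ≡^ 2 n ⟨
    2 ^ₛ n                                                 ≡⟨ binomial n 1 1 ⟩
    Σℕ (suc n) (λ k → ι (bin n k) * (1 ^ₛ k * 1 ^ₛ (n ∸ k))) ≡⟨ Σ-cong≡ (suc n) term ⟩
    Σℕ (suc n) (bin n)                                     ∎)
    where
    one : ∀ k → 1 ^ₛ k ≡ 1
    one k = trans (^ₛ≡^ 1 k) (ℕP.^-zeroˡ k)
    term : ∀ k → ι (bin n k) * (1 ^ₛ k * 1 ^ₛ (n ∸ k)) ≡ bin n k
    term k rewrite one k | one (n ∸ k) = trans (ℕP.*-identityʳ _) (ι≡id _)

  vandermonde : ∀ p q t → Σℕ (suc t) (λ a → bin p a * bin q (t ∸ a)) ≡ bin (p + q) t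
  vandermonde zero q t =
    trans (Σ-shift t _) (trans (cong₂ _+_ (ℕP.+-identityʳ (bin q t)) (Σ-zero t _ (λ _ _ → refl))) (ℕP.+-identityʳ _))
  vandermonde (suc p) q zero = refl
  vandermonde (suc p) q (suc t) = begin
    Σℕ (suc (suc t)) (λ a → bin (suc p) a * bin q (suc t ∸ a))
      ≡⟨ Σ-shift (suc t) _ ⟩
    bin q (suc t) + 0 + Σℕ (suc t) (λ a → (bin p a + bin p (suc a)) * bin q (t ∸ a))
      ≡⟨ cong₂ _+_ (ℕP.+-identityʳ (bin q (suc t)))
           (trans (Σ-cong≡ (suc t) (λ a → ℕP.*-distribʳ-+ (bin q (t ∸ a)) (bin p a) (bin p (suc a)))) (Σ-+ (suc t) _ _)) ⟩
    bin q (suc t) + (Σℕ (suc t) (λ a → bin p a * bin q (t ∸ a)) + R)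
      ≡⟨ cong (λ z → bin q (suc t) + (z + R)) (vandermonde p q t) ⟩
    bin q (suc t) + (bin (p + q) t + R)
      ≡⟨ swap (bin q (suc t)) (bin (p + q) t) R ⟩
    bin (p + q) t + (bin q (suc t) + R)
      ≡⟨ cong (bin (p + q) t +_) (trans (cong (_+ R) (sym (ℕP.*-identityˡ (bin q (suc t)))))
           (sym (Σ-shift (suc t) (λ a → bin p a * bin q (suc t ∸ a))))) ⟩
    bin (p + q) t + Σℕ (suc (suc t)) (λ a → bin p a * bin q (suc t ∸ a))
      ≡⟨ cong (bin (p + q) t +_) (vandermonde p q (suc t)) ⟩
    bin (p + q) t + bin (p + q) (suc t) ∎
    where
    R = Σℕ (suc t) (λ a → bin p (suc a) * bin q (t ∸ a))
    swap : ∀ a b c → a + (b + c) ≡ b + (a + c)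
    swap = solve-∀

  Σtrinomial : ∀ m s → Σℕ (suc m) (λ a → bin m a * bin (m ∸ a) s) ≡ bin m s * 2 ^ (m ∸ s)
  Σtrinomial m s = begin
    Σℕ (suc m) (λ a → bin m a * bin (m ∸ a) s) ≡⟨ Σ-cong≡ (suc m) exchange ⟩
    Σℕ (suc m) (λ a → bin m s * bin (m ∸ s) a) ≡⟨ Σ-*ˡ (suc m) (bin m s) _ ⟨
    bin m s * Σℕ (suc m) (bin (m ∸ s))         ≡⟨ cong (bin m s *_) (Σ-extend (suc (m ∸ s)) (suc m) _ (s≤s (ℕP.m∸n≤m m s))
          (λ i m∸s<i _ → bin-> (m ∸ s) i m∸s<i)) ⟩
    bin m s * Σℕ (suc (m ∸ s)) (bin (m ∸ s))   ≡⟨ cong (bin m s *_) (Σbin (m ∸ s)) ⟩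
    bin m s * 2 ^ (m ∸ s)                      ∎
    where
    exchange : ∀ a → bin m a * bin (m ∸ a) s ≡ bin m s * bin (m ∸ s) a
    exchange a = begin
      bin m a * bin (m ∸ a) s         ≡⟨ trinomial m a s ⟨
      bin m (a + s) * bin (a + s) a   ≡⟨ cong₂ (λ x y → bin m x * y) (ℕP.+-comm a s) (trans (bin-sym a s) (cong (λ z → bin z s) (ℕP.+-comm a s))) ⟩
      bin m (s + a) * bin (s + a) s   ≡⟨ trinomial m s a ⟩
      bin m s * bin (m ∸ s) a         ∎

  -- the k-th row of Pascal's matrix is an eigenvector, with eigenvalue 2^k, of the
  -- matrix  (C(i,j) 2^j)  by which subdivision acts on f-vectors
  pascal-eigenvector : ∀ e k j → k ≤ e → Σℕ (suc e) (λ i → bin k i * (bin i j * 2 ^ j)) ≡ bin k j * 2 ^ k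
  pascal-eigenvector e k j k≤e with j ℕP.≤? k
  ... | yes j≤k = begin
    Σℕ (suc e) g                                              ≡⟨ Σ-window g j k (suc e) j≤k (s≤s k≤e) below above ⟩
    Σℕ (suc (k ∸ j)) (λ a → g (j + a))                        ≡⟨ Σ-cong≡ (suc (k ∸ j)) shifted ⟩
    Σℕ (suc (k ∸ j)) (λ a → (bin k j * 2 ^ j) * bin (k ∸ j) a) ≡⟨ Σ-*ˡ (suc (k ∸ j)) (bin k j * 2 ^ j) (bin (k ∸ j)) ⟨
    (bin k j * 2 ^ j) * Σℕ (suc (k ∸ j)) (bin (k ∸ j))        ≡⟨ cong ((bin k j * 2 ^ j) *_) (Σbin (k ∸ j)) ⟩
    (bin k j * 2 ^ j) * 2 ^ (k ∸ j)                           ≡⟨ ℕP.*-assoc (bin k j) _ _ ⟩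
    bin k j * (2 ^ j * 2 ^ (k ∸ j))                           ≡⟨ cong (bin k j *_) (trans (sym (ℕP.^-distribˡ-+-* 2 j (k ∸ j)))
          (cong (2 ^_) (ℕP.m+[n∸m]≡n j≤k))) ⟩
    bin k j * 2 ^ k                                           ∎
    where
    g : ℕ → ℕ
    g i = bin k i * (bin i j * 2 ^ j)
    below : ∀ i → i < j → g i ≡ 0
    below i i<j = trans (cong (λ z → bin k i * (z * 2 ^ j)) (bin-> i j i<j)) (ℕP.*-zeroʳ (bin k i))
    above : ∀ i → k < i → i < suc e → g i ≡ 0
    above i k<i _ = cong (_* (bin i j * 2 ^ j)) (bin-> k i k<i)
    shifted : ∀ a → g (j + a) ≡ (bin k j * 2 ^ j) * bin (k ∸ j) a
    shifted a = begin
      bin k (j + a) * (bin (j + a) j * 2 ^ j) ≡⟨ ℕP.*-assoc (bin k (j + a)) _ _ ⟨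
      bin k (j + a) * bin (j + a) j * 2 ^ j   ≡⟨ cong (_* 2 ^ j) (trinomial k j a) ⟩
      bin k j * bin (k ∸ j) a * 2 ^ j         ≡⟨ regroup (bin k j) (bin (k ∸ j) a) (2 ^ j) ⟩
      (bin k j * 2 ^ j) * bin (k ∸ j) a       ∎
      where
      regroup : ∀ x y z → x * y * z ≡ (x * z) * y
      regroup = solve-∀
  ... | no j≰k = trans (Σ-zero (suc e) _ vanish) (sym (cong (_* 2 ^ k) (bin-> k j (ℕP.≰⇒> j≰k))))
    where
    vanish : ∀ i → i < suc e → bin k i * (bin i j * 2 ^ j) ≡ 0
    vanish i _ with i ℕP.≤? k
    ... | yes i≤k = trans (cong (λ t → bin k i * (t * 2 ^ j)) (bin-> i j (ℕP.≤-<-trans i≤k (ℕP.≰⇒> j≰k)))) (ℕP.*-zeroʳ (bin k i))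
    ... | no i≰k  = cong (_* (bin i j * 2 ^ j)) (bin-> k i (ℕP.≰⇒> i≰k))


module Counting where

  open import Data.Bool using (Bool; true; false; T; _∧_)
  open import Data.Bool.Properties using (T-≡)
  open import Function.Bundles using (Equivalence)
  open import Data.Unit using (tt)
  open import Data.Nat as ℕ using (ℕ; zero; suc; _+_; _*_; _∸_; _≤_; _<_; z≤n; s≤s; _≡ᵇ_; _≤ᵇ_)
  import Data.Nat.Properties as ℕP
  open import Data.Fin using (Fin; zero; suc)
  open import Data.List using (List; []; _∷_; length; map; filterᵇ; cartesianProduct; allFin; tabulate; lookup; _++_)
  open import Data.List.Membership.Propositional using (_∈_)
  open import Data.List.Membership.Propositional.Properties using (∈-lookup)
  open import Data.List.Relation.Unary.Any using (here; there)
  open import Data.List.Relation.Unary.All.Properties using (All¬⇒¬Any)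
  open import Data.List.Relation.Unary.AllPairs using (_∷_)
  open import Data.List.Relation.Unary.Unique.Propositional using (Unique)
  open import Relation.Binary.PropositionalEquality as ≡ using (_≡_; refl; sym; trans; cong; cong₂)
  open import Data.Product using (_,_; _×_; ∃)
  open import Relation.Nullary using (yes; no; does; ¬_)
  open import Relation.Binary.Definitions using (DecidableEquality)
  open import Data.Empty using (⊥-elim)
  open import Data.Nat.Tactic.RingSolver using (solve-∀)
  open Binomial using (Σℕ; Σ-zero; Σ-+; Σ-*ˡ; Σ-cong; Σ-cong≡; Σ-delta; Σ-extend; bin; bin->)
  open BinomialSums using (vandermonde)

  ∧-intro : ∀ a {b} → T a → T b → T (a ∧ b)
  ∧-intro true _ tb = tb

  ∧-fst : ∀ a {b} → T (a ∧ b) → T a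
  ∧-fst true _ = tt

  ∧-snd : ∀ a {b} → T (a ∧ b) → T b
  ∧-snd true t = t

  T-true : ∀ {b} → T b → b ≡ true
  T-true = Equivalence.to T-≡

  true-T : ∀ {b} → b ≡ true → T b
  true-T = Equivalence.from T-≡

  ind : Bool → ℕ
  ind true  = 1
  ind false = 0

  ind-∧ : ∀ a b → ind (a ∧ b) ≡ ind a * ind b
  ind-∧ true  b = sym (ℕP.+-identityʳ (ind b))
  ind-∧ false b = refl

  ind-true : ∀ {b} → T b → ind b ≡ 1
  ind-true {true} _ = refl

  ind-false : ∀ {b} → ¬ T b → ind b ≡ 0
  ind-false {true}  h = ⊥-elim (h tt)
  ind-false {false} h = refl

  ind-cong : ∀ a b → (T a → T b) → (T b → T a) → ind a ≡ ind b
  ind-cong true  true  _ _ = refl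
  ind-cong false false _ _ = refl
  ind-cong true  false f _ = ⊥-elim (f tt)
  ind-cong false true  _ g = ⊥-elim (g tt)

  sumL : ∀ {A : Set} → List A → (A → ℕ) → ℕ
  sumL []       f = 0
  sumL (x ∷ xs) f = f x + sumL xs f

  cnt : ∀ {A : Set} → (A → Bool) → List A → ℕ
  cnt p xs = length (filterᵇ p xs)

  count : (n : ℕ) → (Fin n → Bool) → ℕ
  count n p = cnt p (allFin n)

  module _ {A : Set} where

    cnt≡sumL : ∀ (p : A → Bool) xs → cnt p xs ≡ sumL xs (λ x → ind (p x))
    cnt≡sumL p [] = refl
    cnt≡sumL p (x ∷ xs) with p x
    ... | true  = cong suc (cnt≡sumL p xs)
    ... | false = cnt≡sumL p xs

    sumL-cong : ∀ xs {f g : A → ℕ} → (∀ x → f x ≡ g x) → sumL xs f ≡ sumL xs g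
    sumL-cong []       h = refl
    sumL-cong (x ∷ xs) h = cong₂ _+_ (h x) (sumL-cong xs h)

    sumL-+ : ∀ xs (f g : A → ℕ) → sumL xs (λ x → f x + g x) ≡ sumL xs f + sumL xs g
    sumL-+ []       f g = refl
    sumL-+ (x ∷ xs) f g = trans (cong (f x + g x +_) (sumL-+ xs f g)) (interchange (f x) (g x) _ _)
      where
      interchange : ∀ a b c d → a + b + (c + d) ≡ a + c + (b + d)
      interchange = solve-∀

    sumL-*ˡ : ∀ xs c (f : A → ℕ) → c * sumL xs f ≡ sumL xs (λ x → c * f x)
    sumL-*ˡ []       c f = ℕP.*-zeroʳ c
    sumL-*ˡ (x ∷ xs) c f = trans (ℕP.*-distribˡ-+ c (f x) _) (cong (c * f x +_) (sumL-*ˡ xs c f))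

    sumL-*ʳ : ∀ xs c (f : A → ℕ) → sumL xs f * c ≡ sumL xs (λ x → f x * c)
    sumL-*ʳ xs c f = trans (ℕP.*-comm _ c) (trans (sumL-*ˡ xs c f) (sumL-cong xs (λ x → ℕP.*-comm c (f x))))

    sumL-zero : ∀ xs (f : A → ℕ) → (∀ x → f x ≡ 0) → sumL xs f ≡ 0
    sumL-zero []       f h = refl
    sumL-zero (x ∷ xs) f h = cong₂ _+_ (h x) (sumL-zero xs f h)

    sumL-++ : ∀ xs ys (f : A → ℕ) → sumL (xs ++ ys) f ≡ sumL xs f + sumL ys f
    sumL-++ []       ys f = refl
    sumL-++ (x ∷ xs) ys f = trans (cong (f x +_) (sumL-++ xs ys f)) (sym (ℕP.+-assoc (f x) _ _))

    sumL-filter : ∀ (p : A → Bool) xs (f : A → ℕ) → sumL (filterᵇ p xs) f ≡ sumL xs (λ x → ind (p x) * f x)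
    sumL-filter p [] f = refl
    sumL-filter p (x ∷ xs) f with p x
    ... | true  = cong₂ _+_ (sym (ℕP.+-identityʳ (f x))) (sumL-filter p xs f)
    ... | false = sumL-filter p xs f

    sumL-ind∧ : ∀ xs b (p : A → Bool) → sumL xs (λ x → ind (b ∧ p x)) ≡ ind b * sumL xs (λ x → ind (p x))
    sumL-ind∧ xs true  p = sym (ℕP.+-identityʳ _)
    sumL-ind∧ xs false p = sumL-zero xs _ (λ _ → refl)

    cnt-mono : ∀ (p q : A → Bool) xs → (∀ x → T (p x) → T (q x)) → cnt p xs ≤ cnt q xs
    cnt-mono p q [] h = z≤n
    cnt-mono p q (x ∷ xs) h with p x in eqp | q x in eqq
    ... | true  | true  = s≤s (cnt-mono p q xs h)
    ... | false | true  = ℕP.m≤n⇒m≤1+n (cnt-mono p q xs h)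
    ... | false | false = cnt-mono p q xs h
    ... | true  | false = ⊥-elim (≡.subst T eqq (h x (true-T eqp)))

    cnt-cong : ∀ (p q : A → Bool) xs → (∀ x → T (p x) → T (q x)) → (∀ x → T (q x) → T (p x)) → cnt p xs ≡ cnt q xs
    cnt-cong p q xs p⇒q q⇒p = ℕP.≤-antisym (cnt-mono p q xs p⇒q) (cnt-mono q p xs q⇒p)

    cnt-witness : ∀ (p : A → Bool) xs → 0 < cnt p xs → ∃ λ x → T (p x)
    cnt-witness p (x ∷ xs) pos with p x in eq
    ... | true  = x , true-T eq
    ... | false = cnt-witness p xs pos

    cnt-pos : ∀ (p : A → Bool) xs x → x ∈ xs → T (p x) → 1 ≤ cnt p xs
    cnt-pos p (y ∷ xs) x (here refl) t with p y
    ... | true = s≤s z≤n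
    cnt-pos p (y ∷ xs) x (there x∈xs) t with p y
    ... | true  = s≤s z≤n
    ... | false = cnt-pos p xs x x∈xs t

    cnt-zero : ∀ (p : A → Bool) xs → (∀ x → ¬ T (p x)) → cnt p xs ≡ 0
    cnt-zero p [] h = refl
    cnt-zero p (x ∷ xs) h with p x in eq
    ... | true  = ⊥-elim (h x (true-T eq))
    ... | false = cnt-zero p xs h

    sumL-unique : (_≟_ : DecidableEquality A) → ∀ xs x → Unique xs → x ∈ xs →
      sumL xs (λ y → ind (does (y ≟ x))) ≡ 1
    sumL-unique _≟_ (y ∷ xs) x (y∉xs ∷ u) (here refl) with y ≟ y
    ... | no y≢y = ⊥-elim (y≢y refl)
    ... | yes _  = cong suc (sumL-zero∈ xs (λ w w∈xs → others w w∈xs))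
      where
      sumL-zero∈ : ∀ zs → (∀ w → w ∈ zs → ind (does (w ≟ y)) ≡ 0) → sumL zs (λ w → ind (does (w ≟ y))) ≡ 0
      sumL-zero∈ []       h = refl
      sumL-zero∈ (w ∷ zs) h = cong₂ _+_ (h w (here refl)) (sumL-zero∈ zs (λ v v∈zs → h v (there v∈zs)))
      others : ∀ w → w ∈ xs → ind (does (w ≟ y)) ≡ 0
      others w w∈xs with w ≟ y
      ... | no _     = refl
      ... | yes refl = ⊥-elim (All¬⇒¬Any y∉xs w∈xs)
    sumL-unique _≟_ (y ∷ xs) x (y∉xs ∷ u) (there x∈xs) with y ≟ x
    ... | yes refl = ⊥-elim (All¬⇒¬Any y∉xs x∈xs)
    ... | no _ = sumL-unique _≟_ xs x u x∈xs

    sumL-fibres : ∀ (xs : List A) (P : A → Bool) (f : A → ℕ) (h : A → ℕ) M → (∀ x → T (P x) → f x ≤ M) →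
      sumL xs (λ x → ind (P x) * h x) ≡ Σℕ (suc M) (λ a → sumL xs (λ x → ind (P x ∧ (f x ≡ᵇ a)) * h x))
    sumL-fibres xs P f h M bound = trans (sumL-cong xs split) (exchange xs)
      where
      one-fibre : ∀ v → v ≤ M → Σℕ (suc M) (λ a → ind (v ≡ᵇ a)) ≡ 1
      one-fibre v v≤M = trans (Σ-delta (suc M) v _ (s≤s v≤M) (λ i _ i≢v → ind-false (λ t → i≢v (sym (ℕP.≡ᵇ⇒≡ v i t)))))
                              (ind-true (ℕP.≡⇒≡ᵇ v v refl))
      split : ∀ x → ind (P x) * h x ≡ Σℕ (suc M) (λ a → ind (P x ∧ (f x ≡ᵇ a)) * h x)
      split x with P x in eq
      ... | false = sym (Σ-zero (suc M) _ (λ _ _ → refl))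
      ... | true  = sym (begin
        Σℕ (suc M) (λ a → ind (f x ≡ᵇ a) * h x)       ≡⟨ Σ-cong≡ (suc M) (λ a → ℕP.*-comm (ind (f x ≡ᵇ a)) (h x)) ⟩
        Σℕ (suc M) (λ a → h x * ind (f x ≡ᵇ a))       ≡⟨ Σ-*ˡ (suc M) (h x) _ ⟨
        h x * Σℕ (suc M) (λ a → ind (f x ≡ᵇ a))       ≡⟨ cong (h x *_) (one-fibre (f x) (bound x (true-T eq))) ⟩
        h x * 1                                       ≡⟨ ℕP.*-identityʳ (h x) ⟩
        h x                                           ≡⟨ ℕP.+-identityʳ (h x) ⟨
        h x + 0                                       ∎)
        where open ≡.≡-Reasoning
      exchange : ∀ ys → sumL ys (λ x → Σℕ (suc M) (λ a → ind (P x ∧ (f x ≡ᵇ a)) * h x))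
                      ≡ Σℕ (suc M) (λ a → sumL ys (λ x → ind (P x ∧ (f x ≡ᵇ a)) * h x))
      exchange []       = sym (Σ-zero (suc M) _ (λ _ _ → refl))
      exchange (y ∷ ys) = trans (cong (_ +_) (exchange ys)) (sym (Σ-+ (suc M) _ _))

    sumL-on-support : ∀ (xs : List A) (P : A → Bool) (h g : A → ℕ) → (∀ x → T (P x) → h x ≡ g x) →
      sumL xs (λ x → ind (P x) * h x) ≡ sumL xs (λ x → ind (P x) * g x)
    sumL-on-support xs P h g h≡g = sumL-cong xs on-support
      where
      on-support : ∀ x → ind (P x) * h x ≡ ind (P x) * g x
      on-support x with P x in eq
      ... | false = refl
      ... | true  = cong (_+ 0) (h≡g x (true-T eq))

    sumL-const : ∀ (xs : List A) (P : A → Bool) (h : A → ℕ) c → (∀ x → T (P x) → h x ≡ c) →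
      sumL xs (λ x → ind (P x) * h x) ≡ cnt P xs * c
    sumL-const xs P h c h≡c =
      trans (sumL-on-support xs P h (λ _ → c) h≡c) (trans (sym (sumL-*ʳ xs c _)) (cong (_* c) (sym (cnt≡sumL P xs))))

    sumL-factor : ∀ xs (g : A → Bool) c (p : A → Bool) →
      sumL xs (λ x → ind (g x) * ind (c ∧ p x)) ≡ ind c * cnt (λ x → g x ∧ p x) xs
    sumL-factor xs g true  p = trans (sumL-cong xs (λ x → sym (ind-∧ (g x) (p x)))) (trans (sym (cnt≡sumL _ xs)) (sym (ℕP.+-identityʳ _)))
    sumL-factor xs g false p = sumL-zero xs _ (λ x → ℕP.*-zeroʳ (ind (g x)))

    cnt-cong≡ : ∀ (p q : A → Bool) xs → (∀ x → p x ≡ q x) → cnt p xs ≡ cnt q xs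
    cnt-cong≡ p q xs p≡q = trans (cnt≡sumL p xs) (trans (sumL-cong xs (λ x → cong ind (p≡q x))) (sym (cnt≡sumL q xs)))

    lookup-injective : ∀ (xs : List A) → Unique xs → ∀ i j → lookup xs i ≡ lookup xs j → i ≡ j
    lookup-injective (x ∷ xs) u           zero    zero    _ = refl
    lookup-injective (x ∷ xs) (x∉xs ∷ u) zero    (suc j) e = ⊥-elim (All¬⇒¬Any x∉xs (≡.subst (_∈ xs) (sym e) (∈-lookup j)))
    lookup-injective (x ∷ xs) (x∉xs ∷ u) (suc i) zero    e = ⊥-elim (All¬⇒¬Any x∉xs (≡.subst (_∈ xs) e (∈-lookup i)))
    lookup-injective (x ∷ xs) (x∉xs ∷ u) (suc i) (suc j) e = cong suc (lookup-injective xs u i j e)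

  vandermonde-truncated : ∀ d₁ d₂ t →
    Σℕ (suc d₁) (λ α → bin d₁ α * (ind (α ≤ᵇ t) * bin d₂ (t ∸ α))) ≡ bin (d₁ + d₂) t
  vandermonde-truncated d₁ d₂ t = begin
    Σℕ (suc d₁) X                                ≡⟨ Σ-extend (suc d₁) (suc (d₁ + t)) X (s≤s (ℕP.m≤m+n d₁ t))
          (λ i d₁<i _ → cong (_* _) (bin-> d₁ i d₁<i)) ⟨
    Σℕ (suc (d₁ + t)) X                          ≡⟨ Σ-extend (suc t) (suc (d₁ + t)) X (s≤s (ℕP.m≤n+m t d₁)) (λ i t<i _ → beyond-t i t<i) ⟩
    Σℕ (suc t) X                                 ≡⟨ Σ-cong (suc t) (λ i i<1+t → cong (bin d₁ i *_) (within-t i (ℕP.≤-pred i<1+t))) ⟩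
    Σℕ (suc t) (λ α → bin d₁ α * bin d₂ (t ∸ α)) ≡⟨ vandermonde d₁ d₂ t ⟩
    bin (d₁ + d₂) t                              ∎
    where
    open ≡.≡-Reasoning
    X : ℕ → ℕ
    X α = bin d₁ α * (ind (α ≤ᵇ t) * bin d₂ (t ∸ α))
    beyond-t : ∀ i → t < i → X i ≡ 0
    beyond-t i t<i = trans (cong (λ z → bin d₁ i * (z * bin d₂ (t ∸ i))) (ind-false (λ i≤t → ℕP.<⇒≱ t<i (ℕP.≤ᵇ⇒≤ i t i≤t))))
      (ℕP.*-zeroʳ (bin d₁ i))
    within-t : ∀ i → i ≤ t → ind (i ≤ᵇ t) * bin d₂ (t ∸ i) ≡ bin d₂ (t ∸ i)
    within-t i i≤t = trans (cong (_* bin d₂ (t ∸ i)) (ind-true (ℕP.≤⇒≤ᵇ i≤t))) (ℕP.+-identityʳ _)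

  sumL-map : ∀ {A B : Set} (g : A → B) xs (f : B → ℕ) → sumL (map g xs) f ≡ sumL xs (λ x → f (g x))
  sumL-map g []       f = refl
  sumL-map g (x ∷ xs) f = cong (f (g x) +_) (sumL-map g xs f)

  sumL-swap : ∀ {A B : Set} (xs : List A) (ys : List B) (f : A → B → ℕ) →
    sumL xs (λ x → sumL ys (λ y → f x y)) ≡ sumL ys (λ y → sumL xs (λ x → f x y))
  sumL-swap []       ys f = sym (sumL-zero ys _ (λ _ → refl))
  sumL-swap (x ∷ xs) ys f = trans (cong (sumL ys (f x) +_) (sumL-swap xs ys f)) (sym (sumL-+ ys (f x) _))

  sumL-cartesian : ∀ {A B : Set} (xs : List A) (ys : List B) (f : A × B → ℕ) →
    sumL (cartesianProduct xs ys) f ≡ sumL xs (λ x → sumL ys (λ y → f (x , y)))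
  sumL-cartesian []       ys f = refl
  sumL-cartesian (x ∷ xs) ys f =
    trans (sumL-++ (map (x ,_) ys) _ f) (cong₂ _+_ (sumL-map (x ,_) ys f) (sumL-cartesian xs ys f))

  sumL-tabulate : ∀ {A : Set} n (g : Fin n → A) (f : A → ℕ) → sumL (tabulate g) f ≡ sumL (allFin n) (λ i → f (g i))
  sumL-tabulate zero    g f = refl
  sumL-tabulate (suc n) g f =
    cong (f (g zero) +_) (trans (sumL-tabulate n (λ i → g (suc i)) f) (sym (sumL-tabulate n suc (λ i → f (g i)))))

  sumL-positions : ∀ {A : Set} (L : List A) (f : A → ℕ) → sumL (allFin (length L)) (λ i → f (lookup L i)) ≡ sumL L f
  sumL-positions []      f = refl
  sumL-positions (x ∷ L) f =
    cong (f x +_) (trans (sumL-tabulate (length L) suc (λ i → f (lookup (x ∷ L) i))) (sumL-positions L f))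

module Monus where

  open import Data.Nat using (_+_; _∸_; _≤_; _<_)
  open import Data.Nat.Properties
  open import Data.Sum using (_⊎_; inj₁; inj₂)
  open import Relation.Binary.PropositionalEquality using (_≡_; sym; trans; cong; subst; module ≡-Reasoning)

  ∸-split : ∀ {a b c} → a ≤ b → b ≤ c → c ∸ a ≡ (b ∸ a) + (c ∸ b)
  ∸-split {a} {b} {c} a≤b b≤c = trans (cong (_∸ a) (sym a+parts≡c)) (m+n∸m≡n a _)
    where
    a+parts≡c : a + ((b ∸ a) + (c ∸ b)) ≡ c
    a+parts≡c = trans (sym (+-assoc a _ _)) (trans (cong (_+ (c ∸ b)) (m+[n∸m]≡n a≤b)) (m+[n∸m]≡n b≤c))

  ∸≡⇒ : ∀ {a b s} → a ≤ b → b ∸ a ≡ s → b ≡ a + s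
  ∸≡⇒ {a} a≤b b∸a≡s = trans (sym (m+[n∸m]≡n a≤b)) (cong (a +_) b∸a≡s)

  ∸≡⇒≡∸ : ∀ {a b s} → a ≤ b → b ∸ a ≡ s → a ≡ b ∸ s
  ∸≡⇒≡∸ {a} {b} a≤b b∸a≡s = trans (sym (m∸[m∸n]≡n a≤b)) (cong (b ∸_) b∸a≡s)

  ≡∸⇒∸≡ : ∀ {a b s} → s ≤ b → a ≡ b ∸ s → b ∸ a ≡ s
  ≡∸⇒∸≡ {a} {b} s≤b a≡b∸s = trans (cong (b ∸_) a≡b∸s) (m∸[m∸n]≡n s≤b)

  ∸-difference : ∀ {a b c} → a ≤ b → b ≤ c → c ∸ b ≡ (c ∸ a) ∸ (b ∸ a)
  ∸-difference {a} {b} {c} a≤b b≤c = sym (trans (cong (_∸ (b ∸ a)) (∸-split a≤b b≤c)) (m+n∸m≡n (b ∸ a) (c ∸ b)))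

  ∸-chain : ∀ {h f g h'} → h ≤ f → f ≤ g → g ≤ h' → h' ∸ h ≡ (g ∸ f) + ((f ∸ h) + (h' ∸ g))
  ∸-chain {h} {f} {g} {h'} h≤f f≤g g≤h' = begin
    h' ∸ h                                 ≡⟨ ∸-split h≤f (≤-trans f≤g g≤h') ⟩
    (f ∸ h) + (h' ∸ f)                     ≡⟨ cong ((f ∸ h) +_) (∸-split f≤g g≤h') ⟩
    (f ∸ h) + ((g ∸ f) + (h' ∸ g))         ≡⟨ sym (+-assoc (f ∸ h) _ _) ⟩
    (f ∸ h) + (g ∸ f) + (h' ∸ g)           ≡⟨ cong (_+ (h' ∸ g)) (+-comm (f ∸ h) _) ⟩
    (g ∸ f) + (f ∸ h) + (h' ∸ g)           ≡⟨ +-assoc (g ∸ f) _ _ ⟩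
    (g ∸ f) + ((f ∸ h) + (h' ∸ g))         ∎
    where open ≡-Reasoning

  ∸-extension⇒ : ∀ {h f g h' t} → h ≤ f → f ≤ g → g ≤ h' → h' ∸ h ≡ (g ∸ f) + t → (f ∸ h) + (h' ∸ g) ≡ t
  ∸-extension⇒ {h} {f} {g} {h'} h≤f f≤g g≤h' e = +-cancelˡ-≡ (g ∸ f) _ _ (trans (sym (∸-chain h≤f f≤g g≤h')) e)

  ∸-extension⇐ : ∀ {h f g h' t} → h ≤ f → f ≤ g → g ≤ h' → (f ∸ h) + (h' ∸ g) ≡ t → h' ∸ h ≡ (g ∸ f) + t
  ∸-extension⇐ {h} {f} {g} {h'} h≤f f≤g g≤h' e = trans (∸-chain h≤f f≤g g≤h') (cong ((g ∸ f) +_) e)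

  ∸-strict : ∀ {a b c d} → a ≤ b → b ≤ c → c ≤ d → (a < b) ⊎ (c < d) → c ∸ b < d ∸ a
  ∸-strict {a} {b} {c} {d} a≤b b≤c c≤d a<b⊎c<d =
    subst (c ∸ b <_) (sym (∸-chain a≤b b≤c c≤d)) (m<m+n (c ∸ b) (ends-positive a<b⊎c<d))
    where
    ends-positive : (a < b) ⊎ (c < d) → 0 < (b ∸ a) + (d ∸ c)
    ends-positive (inj₁ a<b) = <-≤-trans (m<n⇒0<n∸m a<b) (m≤m+n (b ∸ a) (d ∸ c))
    ends-positive (inj₂ c<d) = <-≤-trans (m<n⇒0<n∸m c<d) (m≤n+m (d ∸ c) (b ∸ a))

-- A rank function r on a face poset R is cubical if R is
-- a partial order strictly ranked by r whose intervals and down-sets have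
-- the rank counts of faces of cubes:  a cube [0,1]^m has C(m-k, t) faces of
-- dimension k+t containing a fixed k-face, and C(m,s) 2^(m-s) faces of
-- dimension s.  This is the invariant carried through the subdivisions.

module CubicalRank where

  open import Data.Bool using (true; false; T; _∧_; if_then_else_)
  open import Data.Unit using (tt)
  open import Data.Nat as ℕ using (ℕ; zero; suc; _+_; _*_; _∸_; _^_; _≤_; _<_; z≤n; s≤s; _≡ᵇ_; _⊔_; _⊓_)
  import Data.Nat.Properties as ℕP
  open import Data.Fin using (Fin; _≟_)
  open import Data.List using (List; []; _∷_; map; allFin; foldr)
  open import Data.List.Membership.Propositional using (_∈_)
  open import Data.List.Membership.Propositional.Properties using (∈-allFin)
  open import Data.List.Properties using (length-tabulate; length-filter)
  open import Data.List.Relation.Unary.Any using (here; there)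
  open import Relation.Binary.PropositionalEquality as ≡ using (_≡_; _≢_; refl; sym; trans; cong)
  open import Data.Product using (_,_; _×_; ∃)
  open import Relation.Nullary using (yes; no; ¬_)
  open import Data.Empty using (⊥-elim)
  open Binomial using (bin)
  open Counting
  open Monus using (∸≡⇒; ∸≡⇒≡∸; ≡∸⇒∸≡)

  record IsCubicalRank (R : FaceRel) (r : Fin (size R) → ℕ) : Set where
    field
      -- R is a preorder on which r is strictly increasing (hence a partial order)
      reflexive    : ∀ x → T (le R x x)
      transitive   : ∀ x y z → T (le R x y) → T (le R y z) → T (le R x z)
      strict       : ∀ x y → T (le R y x) → y ≢ x → r y < r x
      intervalRank : ∀ F G → T (le R F G) → ∀ t →
        count (size R) (λ H → le R F H ∧ le R H G ∧ (r H ≡ᵇ r F + t)) ≡ bin (r G ∸ r F) t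
      downRank     : ∀ G s →
        count (size R) (λ F → le R F G ∧ (r F ≡ᵇ s)) ≡ bin (r G) s * 2 ^ (r G ∸ s)

  maximum-≤ : ∀ {A : Set} (xs : List A) (g : A → ℕ) B → (∀ y → g y ≤ B) → foldr _⊔_ 0 (map g xs) ≤ B
  maximum-≤ []       g B h = z≤n
  maximum-≤ (x ∷ xs) g B h = ℕP.⊔-lub (h x) (maximum-≤ xs g B h)

  ≤-maximum : ∀ {A : Set} (xs : List A) (g : A → ℕ) y → y ∈ xs → g y ≤ foldr _⊔_ 0 (map g xs)
  ≤-maximum (x ∷ xs) g y (here refl)   = ℕP.m≤m⊔n (g x) _
  ≤-maximum (x ∷ xs) g y (there y∈xs) = ℕP.≤-trans (≤-maximum xs g y y∈xs) (ℕP.m≤n⊔m (g x) _)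

  n<2^n : ∀ n → n < 2 ^ n
  n<2^n zero    = s≤s z≤n
  n<2^n (suc n) = ℕP.+-mono-≤-< (ℕP.m^n>0 2 n) (ℕP.<-≤-trans (n<2^n n) (ℕP.m≤m+n (2 ^ n) 0))

  -- consequences of a cubical rank: it is the dimension (height) function,
  -- so f-vectors count elements by rank
  module Properties {R : FaceRel} {r : Fin (size R) → ℕ} (isRank : IsCubicalRank R r) where
    open IsCubicalRank isRank

    monotone : ∀ x y → T (le R y x) → r y ≤ r x
    monotone x y y≤x with y ≟ x
    ... | yes refl = ℕP.≤-refl
    ... | no y≢x   = ℕP.<⇒≤ (strict x y y≤x y≢x)

    covered : ∀ x p → r x ≡ suc p → ∃ λ y → T (le R y x) × (r y ≡ p)
    covered x p rx≡1+p with cnt-witness (λ F → le R F x ∧ (r F ≡ᵇ p)) (allFin (size R)) positive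
      where
      positive : 0 < count (size R) (λ F → le R F x ∧ (r F ≡ᵇ p))
      positive rewrite downRank x p | rx≡1+p =
        ℕP.*-mono-≤ (Binomial.bin-pos (suc p) p (ℕP.n≤1+n p)) (ℕP.m^n>0 2 (suc p ∸ p))
    ... | y , t = y , ∧-fst (le R y x) t , ℕP.≡ᵇ⇒≡ (r y) p (∧-snd (le R y x) t)

    lt-elim : ∀ y x → T (lt R y x) → T (le R y x) × (y ≢ x)
    lt-elim y x t with y ≟ x
    ... | no y≢x = ∧-fst (le R y x) t , y≢x
    ... | yes _  = ⊥-elim (∧-snd (le R y x) t)

    lt-intro : ∀ y x → T (le R y x) → y ≢ x → lt R y x ≡ true
    lt-intro y x y≤x y≢x with y ≟ x
    ... | yes y≡x = ⊥-elim (y≢x y≡x)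
    ... | no _    = T-true (∧-intro (le R y x) y≤x tt)

    height≡ : ∀ k x → height R k x ≡ k ⊓ r x
    height≡ zero    x = refl
    height≡ (suc k) x = ℕP.≤-antisym upper lower
      where
      step : Fin (size R) → ℕ
      step y = if lt R y x then suc (height R k y) else 0
      step≤ : ∀ y → step y ≤ suc k ⊓ r x
      step≤ y with lt R y x in eq
      ... | false = z≤n
      ... | true with lt-elim y x (true-T eq)
      ...   | y≤x , y≢x rewrite height≡ k y = ℕP.⊓-mono-≤ (ℕP.≤-refl {suc k}) (strict x y y≤x y≢x)
      upper : height R (suc k) x ≤ suc k ⊓ r x
      upper = maximum-≤ (allFin (size R)) step (suc k ⊓ r x) step≤
      lower : suc k ⊓ r x ≤ height R (suc k) x
      lower with r x in eqr
      ... | zero  = z≤n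
      ... | suc p with covered x p eqr
      ...   | y , y≤x , ry≡p = ℕP.≤-trans (ℕP.≤-reflexive attained) (≤-maximum (allFin (size R)) step y (∈-allFin y))
        where
        y≢x : y ≢ x
        y≢x refl = ℕP.<-irrefl (trans (sym ry≡p) eqr) (ℕP.n<1+n p)
        attained : suc k ⊓ suc p ≡ step y
        attained rewrite lt-intro y x y≤x y≢x | height≡ k y | ry≡p = refl

    -- there are 2^(r x) vertices below x, so r x < 2^(r x) ≤ size R
    rank≤size : ∀ x → r x ≤ size R
    rank≤size x = ℕP.≤-trans (ℕP.<⇒≤ (n<2^n (r x))) (ℕP.≤-trans (ℕP.≤-reflexive vertices)
                    (ℕP.≤-trans (length-filter _ (allFin (size R))) (ℕP.≤-reflexive (length-tabulate (λ i → i)))))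
      where
      vertices : 2 ^ r x ≡ count (size R) (λ F → le R F x ∧ (r F ≡ᵇ 0))
      vertices = sym (trans (downRank x 0) (ℕP.+-identityʳ _))

    dim≡rank : ∀ x → dim R x ≡ r x
    dim≡rank x = trans (height≡ (size R) x) (ℕP.m≥n⇒m⊓n≡n (rank≤size x))

    above-between : ∀ H G s →
      count (size R) (λ H' → le R H H' ∧ (le R H' G ∧ (r H' ∸ r H ≡ᵇ s))) ≡ ind (le R H G) * bin (r G ∸ r H) s
    above-between H G s with le R H G in eq
    ... | false = cnt-zero _ (allFin (size R)) (λ H' t → ≡.subst T eq
          (transitive H H' G (∧-fst (le R H H') t) (∧-fst (le R H' G) (∧-snd (le R H H') t))))
    ... | true = trans (cnt-cong _ _ (allFin (size R)) fw bw) (trans (intervalRank H G (true-T eq) s) (sym (ℕP.+-identityʳ _)))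
      where
      fw : ∀ H' → T (le R H H' ∧ (le R H' G ∧ (r H' ∸ r H ≡ᵇ s))) → T (le R H H' ∧ (le R H' G ∧ (r H' ≡ᵇ r H + s)))
      fw H' t = ∧-intro (le R H H') H≤H' (∧-intro (le R H' G) (∧-fst (le R H' G) rest)
                  (ℕP.≡⇒≡ᵇ (r H') (r H + s) (∸≡⇒ (monotone H' H H≤H') (ℕP.≡ᵇ⇒≡ (r H' ∸ r H) s (∧-snd (le R H' G) rest)))))
        where
        H≤H' = ∧-fst (le R H H') t
        rest = ∧-snd (le R H H') t
      bw : ∀ H' → T (le R H H' ∧ (le R H' G ∧ (r H' ≡ᵇ r H + s))) → T (le R H H' ∧ (le R H' G ∧ (r H' ∸ r H ≡ᵇ s)))
      bw H' t = ∧-intro (le R H H') (∧-fst (le R H H') t) (∧-intro (le R H' G) (∧-fst (le R H' G) rest)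
                  (ℕP.≡⇒≡ᵇ (r H' ∸ r H) s (≡.subst (λ z → z ∸ r H ≡ s) (sym (ℕP.≡ᵇ⇒≡ (r H') (r H + s) (∧-snd (le R H' G) rest)))
                    (ℕP.m+n∸m≡n (r H) s))))
        where
        rest = ∧-snd (le R H H') t

    below-between : ∀ F' F → T (le R F' F) → ∀ α → α ≤ r F ∸ r F' →
      count (size R) (λ H → le R F' H ∧ (le R H F ∧ (r F ∸ r H ≡ᵇ α))) ≡ bin (r F ∸ r F') α
    below-between F' F F'≤F α α≤d = begin
      count (size R) (λ H → le R F' H ∧ (le R H F ∧ (r F ∸ r H ≡ᵇ α)))
        ≡⟨ cnt-cong _ _ (allFin (size R)) fw bw ⟩
      count (size R) (λ H → le R F' H ∧ (le R H F ∧ (r H ≡ᵇ r F ∸ α)))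
        ≡⟨ cong (λ z → count (size R) (λ H → le R F' H ∧ (le R H F ∧ (r H ≡ᵇ z)))) rF∸α ⟩
      count (size R) (λ H → le R F' H ∧ (le R H F ∧ (r H ≡ᵇ r F' + (d ∸ α))))
        ≡⟨ intervalRank F' F F'≤F (d ∸ α) ⟩
      bin d (d ∸ α)
        ≡⟨ Binomial.bin-complement α≤d ⟩
      bin d α ∎
      where
      open ≡.≡-Reasoning
      d = r F ∸ r F'
      rF'≤rF = monotone F F' F'≤F
      α≤rF = ℕP.≤-trans α≤d (ℕP.m∸n≤m (r F) (r F'))
      rF∸α : r F ∸ α ≡ r F' + (d ∸ α)
      rF∸α = trans (cong (_∸ α) (sym (ℕP.m+[n∸m]≡n rF'≤rF))) (ℕP.+-∸-assoc (r F') α≤d)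
      fw : ∀ H → T (le R F' H ∧ (le R H F ∧ (r F ∸ r H ≡ᵇ α))) → T (le R F' H ∧ (le R H F ∧ (r H ≡ᵇ r F ∸ α)))
      fw H t = ∧-intro (le R F' H) (∧-fst (le R F' H) t) (∧-intro (le R H F) H≤F
                 (ℕP.≡⇒≡ᵇ (r H) (r F ∸ α) (∸≡⇒≡∸ (monotone F H H≤F) (ℕP.≡ᵇ⇒≡ (r F ∸ r H) α (∧-snd (le R H F) rest)))))
        where
        rest = ∧-snd (le R F' H) t
        H≤F = ∧-fst (le R H F) rest
      bw : ∀ H → T (le R F' H ∧ (le R H F ∧ (r H ≡ᵇ r F ∸ α))) → T (le R F' H ∧ (le R H F ∧ (r F ∸ r H ≡ᵇ α)))
      bw H t = ∧-intro (le R F' H) (∧-fst (le R F' H) t) (∧-intro (le R H F) (∧-fst (le R H F) rest)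
                 (ℕP.≡⇒≡ᵇ (r F ∸ r H) α (≡∸⇒∸≡ α≤rF (ℕP.≡ᵇ⇒≡ (r H) (r F ∸ α) (∧-snd (le R H F) rest)))))
        where
        rest = ∧-snd (le R F' H) t

    below-count : ∀ G j → count (size R) (λ F → le R F G ∧ (r G ∸ r F ≡ᵇ j)) ≡ bin (r G) j * 2 ^ j
    below-count G j with j ℕP.≤? r G
    ... | yes j≤rG = trans (cnt-cong _ _ (allFin (size R)) fw bw)
          (trans (downRank G (r G ∸ j)) (≡.cong₂ (λ x y → x * 2 ^ y) (Binomial.bin-complement j≤rG) (ℕP.m∸[m∸n]≡n j≤rG)))
      where
      fw : ∀ F → T (le R F G ∧ (r G ∸ r F ≡ᵇ j)) → T (le R F G ∧ (r F ≡ᵇ r G ∸ j))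
      fw F t = ∧-intro (le R F G) F≤G (ℕP.≡⇒≡ᵇ (r F) (r G ∸ j)
          (∸≡⇒≡∸ (monotone G F F≤G) (ℕP.≡ᵇ⇒≡ (r G ∸ r F) j (∧-snd (le R F G) t))))
        where F≤G = ∧-fst (le R F G) t
      bw : ∀ F → T (le R F G ∧ (r F ≡ᵇ r G ∸ j)) → T (le R F G ∧ (r G ∸ r F ≡ᵇ j))
      bw F t = ∧-intro (le R F G) (∧-fst (le R F G) t) (ℕP.≡⇒≡ᵇ (r G ∸ r F) j
          (≡∸⇒∸≡ j≤rG (ℕP.≡ᵇ⇒≡ (r F) (r G ∸ j) (∧-snd (le R F G) t))))
    ... | no j≰rG = trans (cnt-zero _ (allFin (size R)) too-long) (sym (cong (_* 2 ^ j) (Binomial.bin-> (r G) j (ℕP.≰⇒> j≰rG))))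
      where
      too-long : ∀ F → ¬ T (le R F G ∧ (r G ∸ r F ≡ᵇ j))
      too-long F t = j≰rG (≡.subst (_≤ r G) (ℕP.≡ᵇ⇒≡ (r G ∸ r F) j (∧-snd (le R F G) t)) (ℕP.m∸n≤m (r G) (r F)))

    fvec≡count : ∀ j → fvec R j ≡ count (size R) (λ x → r x ≡ᵇ j)
    fvec≡count j = cnt-cong _ _ (allFin (size R))
      (λ x t → ℕP.≡⇒≡ᵇ (r x) j (trans (sym (dim≡rank x)) (ℕP.≡ᵇ⇒≡ (dim R x) j t)))
      (λ x t → ℕP.≡⇒≡ᵇ (dim R x) j (trans (dim≡rank x) (ℕP.≡ᵇ⇒≡ (r x) j t)))

-- The dimension of a face is its
-- number of ⋆'s.

module Cube where

  open import Data.Bool using (Bool; true; false; T; _∧_)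
  open import Data.Unit using (tt)
  open import Data.Nat as ℕ using (ℕ; zero; suc; _+_; _*_; _∸_; _^_; _≤_; _<_; z≤n; s≤s; _≡ᵇ_)
  import Data.Nat.Properties as ℕP
  open import Data.Fin using (Fin; zero; suc) renaming (_≟_ to _≟ᶠ_)
  open import Data.Vec as Vec using (Vec; []; _∷_)
  open import Data.Vec.Properties using (≡-dec)
  open import Data.List using (List; []; _∷_; map; _++_)
  open import Relation.Binary.PropositionalEquality as ≡ using (_≡_; refl; sym; trans; cong; cong₂)
  open import Data.Sum using (_⊎_; inj₁; inj₂)
  open import Relation.Nullary using (Dec; does; yes; no)
  open import Data.Empty using (⊥-elim)
  open import Data.Nat.Tactic.RingSolver using (solve-∀)
  open Binomial using (bin; bin->)
  open Counting
  open ≡.≡-Reasoning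

  Letter : Set
  Letter = Fin 3

  c₀ c₁ ⋆ : Letter
  c₀ = zero
  c₁ = suc zero
  ⋆  = suc (suc zero)

  isStar : Letter → ℕ
  isStar (suc (suc zero)) = 1
  isStar _                = 0

  cdim : ∀ {m} → CubeFace m → ℕ
  cdim []      = 0
  cdim (a ∷ u) = isStar a + cdim u

  letterLe : Letter → Letter → Bool
  letterLe a                (suc (suc zero)) = true
  letterLe zero             zero             = true
  letterLe (suc zero)       (suc zero)       = true
  letterLe _                _                = false

  faceLe : ∀ {m} → CubeFace m → CubeFace m → Bool
  faceLe []      []      = true
  faceLe (a ∷ u) (b ∷ v) = letterLe a b ∧ faceLe u v

  _≟_ : ∀ {m} (u v : CubeFace m) → Dec (u ≡ v)
  _≟_ = ≡-dec _≟ᶠ_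

  allFaces : ∀ m → List (CubeFace m)
  allFaces zero    = [] ∷ []
  allFaces (suc m) = map (c₀ ∷_) (allFaces m) ++ (map (c₁ ∷_) (allFaces m) ++ map (⋆ ∷_) (allFaces m))

  sumFaces-split : ∀ m (f : CubeFace (suc m) → ℕ) → sumL (allFaces (suc m)) f
    ≡ sumL (allFaces m) (λ v → f (c₀ ∷ v)) + (sumL (allFaces m) (λ v → f (c₁ ∷ v)) + sumL (allFaces m) (λ v → f (⋆ ∷ v)))
  sumFaces-split m f = trans (sumL-++ (map (c₀ ∷_) (allFaces m)) _ f) (cong₂ _+_ (sumL-map (c₀ ∷_) (allFaces m) f)
    (trans (sumL-++ (map (c₁ ∷_) (allFaces m)) _ f) (cong₂ _+_ (sumL-map (c₁ ∷_) (allFaces m) f) (sumL-map (⋆ ∷_) (allFaces m) f))))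

  sumFaces-delta : ∀ m (v : CubeFace m) → sumL (allFaces m) (λ w → ind (does (w ≟ v))) ≡ 1
  sumFaces-delta zero    []      = refl
  sumFaces-delta (suc m) (b ∷ v) = begin
    sumL (allFaces (suc m)) (λ w → ind (does (w ≟ (b ∷ v))))
      ≡⟨ sumFaces-split m _ ⟩
    S c₀ + (S c₁ + S ⋆)
      ≡⟨ cong₂ _+_ (sumL-ind∧ (allFaces m) (does (c₀ ≟ᶠ b)) _)
           (cong₂ _+_ (sumL-ind∧ (allFaces m) (does (c₁ ≟ᶠ b)) _) (sumL-ind∧ (allFaces m) (does (⋆ ≟ᶠ b)) _)) ⟩
    ind (does (c₀ ≟ᶠ b)) * D + (ind (does (c₁ ≟ᶠ b)) * D + ind (does (⋆ ≟ᶠ b)) * D)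
      ≡⟨ cong (λ z → ind (does (c₀ ≟ᶠ b)) * z + (ind (does (c₁ ≟ᶠ b)) * z + ind (does (⋆ ≟ᶠ b)) * z)) (sumFaces-delta m v) ⟩
    ind (does (c₀ ≟ᶠ b)) * 1 + (ind (does (c₁ ≟ᶠ b)) * 1 + ind (does (⋆ ≟ᶠ b)) * 1)
      ≡⟨ one-letter b ⟩
    1 ∎
    where
    S : Letter → ℕ
    S a = sumL (allFaces m) (λ w → ind (does ((a ∷ w) ≟ (b ∷ v))))
    D = sumL (allFaces m) (λ w → ind (does (w ≟ v)))
    one-letter : ∀ b → ind (does (c₀ ≟ᶠ b)) * 1 + (ind (does (c₁ ≟ᶠ b)) * 1 + ind (does (⋆ ≟ᶠ b)) * 1) ≡ 1
    one-letter zero             = refl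
    one-letter (suc zero)       = refl
    one-letter (suc (suc zero)) = refl

  #faces : ∀ m → sumL (allFaces m) (λ _ → 1) ≡ 3 ^ m
  #faces zero    = refl
  #faces (suc m) = trans (sumFaces-split m _) (trans (cong (λ z → z + (z + z)) (#faces m)) (triple (3 ^ m)))
    where
    triple : ∀ x → x + (x + x) ≡ 3 * x
    triple = solve-∀

  #faces-below : ∀ m (u : CubeFace m) → sumL (allFaces m) (λ v → ind (faceLe v u)) ≡ 3 ^ cdim u
  #faces-below zero    []      = refl
  #faces-below (suc m) (a ∷ u) = begin
    sumL (allFaces (suc m)) (λ v → ind (faceLe v (a ∷ u)))
      ≡⟨ sumFaces-split m _ ⟩
    S c₀ + (S c₁ + S ⋆)
      ≡⟨ cong₂ _+_ (sumL-ind∧ (allFaces m) (letterLe c₀ a) _)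
           (cong₂ _+_ (sumL-ind∧ (allFaces m) (letterLe c₁ a) _) (sumL-ind∧ (allFaces m) (letterLe ⋆ a) _)) ⟩
    ind (letterLe c₀ a) * D + (ind (letterLe c₁ a) * D + ind (letterLe ⋆ a) * D)
      ≡⟨ cong (λ z → ind (letterLe c₀ a) * z + (ind (letterLe c₁ a) * z + ind (letterLe ⋆ a) * z)) (#faces-below m u) ⟩
    ind (letterLe c₀ a) * 3 ^ cdim u + (ind (letterLe c₁ a) * 3 ^ cdim u + ind (letterLe ⋆ a) * 3 ^ cdim u)
      ≡⟨ letters-below a (3 ^ cdim u) ⟩
    3 ^ isStar a * 3 ^ cdim u
      ≡⟨ ℕP.^-distribˡ-+-* 3 (isStar a) (cdim u) ⟨
    3 ^ cdim (a ∷ u) ∎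
    where
    S : Letter → ℕ
    S b = sumL (allFaces m) (λ v → ind (faceLe (b ∷ v) (a ∷ u)))
    D = sumL (allFaces m) (λ v → ind (faceLe v u))
    letters-below : ∀ a x → ind (letterLe c₀ a) * x + (ind (letterLe c₁ a) * x + ind (letterLe ⋆ a) * x) ≡ 3 ^ isStar a * x
    letters-below zero             = solve-∀
    letters-below (suc zero)       = solve-∀
    letters-below (suc (suc zero)) = solve-∀

  cdim≤ : ∀ {m} (u : CubeFace m) → cdim u ≤ m
  cdim≤ []                    = z≤n
  cdim≤ (zero ∷ u)            = ℕP.m≤n⇒m≤1+n (cdim≤ u)
  cdim≤ (suc zero ∷ u)        = ℕP.m≤n⇒m≤1+n (cdim≤ u)
  cdim≤ (suc (suc zero) ∷ u)  = s≤s (cdim≤ u)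

  cdim-mono : ∀ {m} (u w : CubeFace m) → T (faceLe u w) → cdim u ≤ cdim w
  cdim-mono []      []      _ = z≤n
  cdim-mono (a ∷ u) (b ∷ w) t = ℕP.+-mono-≤ (isStar-mono a b (∧-fst (letterLe a b) t)) (cdim-mono u w (∧-snd (letterLe a b) t))
    where
    isStar-mono : ∀ a b → T (letterLe a b) → isStar a ≤ isStar b
    isStar-mono zero             (suc (suc zero)) _ = z≤n
    isStar-mono (suc zero)       (suc (suc zero)) _ = z≤n
    isStar-mono (suc (suc zero)) (suc (suc zero)) _ = s≤s z≤n
    isStar-mono zero             zero             _ = z≤n
    isStar-mono (suc zero)       (suc zero)       _ = z≤n

  #faces-of-dim : ∀ m s → sumL (allFaces m) (λ v → ind (cdim v ≡ᵇ s)) ≡ bin m s * 2 ^ (m ∸ s)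
  #faces-of-dim zero    zero    = refl
  #faces-of-dim zero    (suc s) = refl
  #faces-of-dim (suc m) zero    =
    trans (sumFaces-split m _) (trans (cong₂ _+_ (#faces-of-dim m 0) (cong₂ _+_ (#faces-of-dim m 0) (sumL-zero (allFaces m) _ (λ _ → refl)))) (double (2 ^ m)))
    where
    double : ∀ x → 1 * x + (1 * x + 0) ≡ 1 * (2 * x)
    double = solve-∀
  #faces-of-dim (suc m) (suc s) =
    trans (sumFaces-split m _) (trans (cong₂ _+_ (#faces-of-dim m (suc s)) (cong₂ _+_ (#faces-of-dim m (suc s)) (#faces-of-dim m s))) (pascal (s ℕP.<? m)))
    where
    pascal : Dec (s < m) → bin m (suc s) * 2 ^ (m ∸ suc s) + (bin m (suc s) * 2 ^ (m ∸ suc s) + bin m s * 2 ^ (m ∸ s))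
                          ≡ (bin m s + bin m (suc s)) * 2 ^ (m ∸ s)
    pascal (yes s<m) rewrite ℕP.+-∸-assoc 1 s<m = identity (bin m (suc s)) (bin m s) (2 ^ (m ∸ suc s))
      where
      identity : ∀ b₁ b₀ p → b₁ * p + (b₁ * p + b₀ * (2 * p)) ≡ (b₀ + b₁) * (2 * p)
      identity = solve-∀
    pascal (no s≮m) rewrite bin-> m (suc s) (s≤s (ℕP.≮⇒≥ s≮m)) = cong (_* 2 ^ (m ∸ s)) (sym (ℕP.+-identityʳ (bin m s)))

  -- faces w ⊇ u whose first letter is ⋆ (and u's is not), by the dimension of w
  #star-extensions : ℕ → ℕ → ℕ
  #star-extensions b zero    = 0
  #star-extensions b (suc t) = bin b t

  -- Pascal's rule for the faces above u ⊆ [0,1]^(m+1) whose first letter is not ⋆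
  pascal-step : ∀ m (u : CubeFace m) t →
    bin (m ∸ cdim u) t + (0 + #star-extensions (m ∸ cdim u) t) ≡ bin (suc m ∸ cdim u) t
  pascal-step m u t rewrite ℕP.+-∸-assoc 1 (cdim≤ u) = pascal (m ∸ cdim u) t
    where
    pascal : ∀ b t → bin b t + (0 + #star-extensions b t) ≡ bin (suc b) t
    pascal b zero    = refl
    pascal b (suc t) = ℕP.+-comm (bin b (suc t)) (bin b t)

  #faces-above : ∀ m (u : CubeFace m) t →
    sumL (allFaces m) (λ w → ind (faceLe u w ∧ (cdim w ≡ᵇ cdim u + t))) ≡ bin (m ∸ cdim u) t
  #faces-above-⋆ : ∀ m (u : CubeFace m) t →
    sumL (allFaces m) (λ w → ind (faceLe u w ∧ (suc (cdim w) ≡ᵇ cdim u + t))) ≡ #star-extensions (m ∸ cdim u) t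

  #faces-above zero [] zero    = refl
  #faces-above zero [] (suc t) = refl
  #faces-above (suc m) (suc (suc zero) ∷ u) t =
    trans (sumFaces-split m _) (cong₂ _+_ (sumL-zero (allFaces m) _ (λ _ → refl)) (cong₂ _+_ (sumL-zero (allFaces m) _ (λ _ → refl)) (#faces-above m u t)))
  #faces-above (suc m) (zero ∷ u) t = trans (sumFaces-split m _)
    (trans (cong₂ _+_ (#faces-above m u t) (cong₂ _+_ (sumL-zero (allFaces m) _ (λ _ → refl)) (#faces-above-⋆ m u t))) (pascal-step m u t))
  #faces-above (suc m) (suc zero ∷ u) t = trans (sumFaces-split m _)
    (trans (cong₂ _+_ (sumL-zero (allFaces m) _ (λ _ → refl)) (cong₂ _+_ (#faces-above m u t) (#faces-above-⋆ m u t))) (pascal-step m u t))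

  #faces-above-⋆ m u zero = sumL-zero (allFaces m) _ (λ w → ind-false (λ t →
    ℕP.<-irrefl refl (ℕP.≤-trans (s≤s (cdim-mono u w (∧-fst (faceLe u w) t)))
      (ℕP.≤-reflexive (trans (ℕP.≡ᵇ⇒≡ (suc (cdim w)) (cdim u + 0) (∧-snd (faceLe u w) t)) (ℕP.+-identityʳ (cdim u)))))))
  #faces-above-⋆ m u (suc t) =
    trans (sumL-cong (allFaces m) (λ w → cong (λ z → ind (faceLe u w ∧ (suc (cdim w) ≡ᵇ z))) (ℕP.+-suc (cdim u) t))) (#faces-above m u t)

  letterLe-sound : ∀ a b → T (letterLe a b) → (b ≡ ⋆) ⊎ (a ≡ b)
  letterLe-sound zero             (suc (suc zero)) _ = inj₁ refl
  letterLe-sound (suc zero)       (suc (suc zero)) _ = inj₁ refl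
  letterLe-sound (suc (suc zero)) (suc (suc zero)) _ = inj₁ refl
  letterLe-sound zero             zero             _ = inj₂ refl
  letterLe-sound (suc zero)       (suc zero)       _ = inj₂ refl

  letterLe-complete : ∀ a b → (b ≡ ⋆) ⊎ (a ≡ b) → T (letterLe a b)
  letterLe-complete a                (suc (suc zero)) _          = tt
  letterLe-complete zero             zero             _          = tt
  letterLe-complete (suc zero)       (suc zero)       _          = tt
  letterLe-complete zero             (suc zero)       (inj₁ ())
  letterLe-complete zero             (suc zero)       (inj₂ ())
  letterLe-complete (suc zero)       zero             (inj₁ ())
  letterLe-complete (suc zero)       zero             (inj₂ ())
  letterLe-complete (suc (suc zero)) zero             (inj₁ ())
  letterLe-complete (suc (suc zero)) zero             (inj₂ ())
  letterLe-complete (suc (suc zero)) (suc zero)       (inj₁ ())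
  letterLe-complete (suc (suc zero)) (suc zero)       (inj₂ ())

  cubeLe⇒faceLe : ∀ {m} (u v : CubeFace m) → cubeLe u v → T (faceLe u v)
  cubeLe⇒faceLe []      []      _ = tt
  cubeLe⇒faceLe (a ∷ u) (b ∷ v) h = ∧-intro (letterLe a b) (letterLe-complete a b (h zero)) (cubeLe⇒faceLe u v (λ i → h (suc i)))

  faceLe⇒cubeLe : ∀ {m} (u v : CubeFace m) → T (faceLe u v) → cubeLe u v
  faceLe⇒cubeLe (a ∷ u) (b ∷ v) t zero    = letterLe-sound a b (∧-fst (letterLe a b) t)
  faceLe⇒cubeLe (a ∷ u) (b ∷ v) t (suc i) = faceLe⇒cubeLe u v (∧-snd (letterLe a b) t) i

  top : ∀ m → CubeFace m
  top m = Vec.replicate m ⋆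

  top-maximal : ∀ {m} (w : CubeFace m) → T (faceLe (top m) w) → w ≡ top m
  top-maximal []      _ = refl
  top-maximal (b ∷ w) t = cong₂ _∷_ (⋆≤ b (∧-fst (letterLe ⋆ b) t)) (top-maximal w (∧-snd (letterLe ⋆ b) t))
    where
    ⋆≤ : ∀ b → T (letterLe ⋆ b) → b ≡ ⋆
    ⋆≤ (suc (suc zero)) _ = refl

  full-dim⇒top : ∀ {m} (u : CubeFace m) → cdim u ≡ m → u ≡ top m
  full-dim⇒top []                   _ = refl
  full-dim⇒top (zero ∷ u)           e = ⊥-elim (ℕP.<-irrefl e (s≤s (cdim≤ u)))
  full-dim⇒top (suc zero ∷ u)       e = ⊥-elim (ℕP.<-irrefl e (s≤s (cdim≤ u)))
  full-dim⇒top (suc (suc zero) ∷ u) e = cong (⋆ ∷_) (full-dim⇒top u (ℕP.suc-injective e))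

-- The face poset of a cubical complex has a cubical rank: the dimension of
-- each face G, i.e. the m with  {F ≤ G} ≅ faces of [0,1]^m.  All counts are
-- transported from the cube of G.

module CubicalComplexRank (K : FaceRel) (isComplex : IsCubicalComplex K) where

  open import Data.Bool using (Bool; true; false; T; _∧_)
  open import Data.Unit using (tt)
  open import Data.Nat as ℕ using (ℕ; _+_; _*_; _∸_; _^_; _≤_; _<_; z≤n; s≤s; _≡ᵇ_)
  import Data.Nat.Properties as ℕP
  open import Data.Fin using (Fin; _≟_)
  open import Data.List using (allFin)
  open import Data.List.Membership.Propositional.Properties using (∈-allFin)
  open import Data.List.Relation.Unary.Unique.Propositional.Properties using (allFin⁺)
  open import Relation.Binary.PropositionalEquality as ≡ using (_≡_; _≢_; refl; sym; trans; cong; subst)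
  open import Data.Product using (_,_; proj₁; proj₂)
  open import Relation.Nullary using (yes; no; does)
  open import Data.Empty using (⊥-elim)
  open import Function.Bundles using (Inverse)
  open import Data.Bool.Properties using (T-irrelevant)
  open import Relation.Binary.Definitions using (tri<; tri≈; tri>)
  open Binomial using (bin)
  open Counting
  open Cube using (allFaces; cdim; faceLe; cdim≤; top; top-maximal; full-dim⇒top; cubeLe⇒faceLe; faceLe⇒cubeLe)
  open CubicalRank using (IsCubicalRank)
  open ≡.≡-Reasoning

  private
    n = size K
    isOrder = proj₁ isComplex
    isCube  = proj₁ (proj₂ isComplex)

  reflexive : ∀ x → T (le K x x)
  reflexive = proj₁ isOrder

  transitive : ∀ x y z → T (le K x y) → T (le K y z) → T (le K x z)
  transitive = proj₂ (proj₂ isOrder)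

  rank : Fin n → ℕ
  rank G = proj₁ (isCube G)

  to : ∀ G → Below K G → CubeFace (rank G)
  to G = Inverse.to (proj₁ (proj₂ (isCube G)))

  from : ∀ G → CubeFace (rank G) → Below K G
  from G = Inverse.from (proj₁ (proj₂ (isCube G)))

  to-from : ∀ G v → to G (from G v) ≡ v
  to-from G = Inverse.strictlyInverseˡ (proj₁ (proj₂ (isCube G)))

  from-to : ∀ G a → from G (to G a) ≡ a
  from-to G = Inverse.strictlyInverseʳ (proj₁ (proj₂ (isCube G)))

  face : ∀ G → CubeFace (rank G) → Fin n
  face G v = proj₁ (from G v)

  order⇒ : ∀ G (a b : Below K G) → T (le K (proj₁ a) (proj₁ b)) → T (faceLe (to G a) (to G b))
  order⇒ G a b t = cubeLe⇒faceLe (to G a) (to G b) (proj₁ (proj₂ (proj₂ (isCube G)) a b) t)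

  order⇐ : ∀ G (a b : Below K G) → T (faceLe (to G a) (to G b)) → T (le K (proj₁ a) (proj₁ b))
  order⇐ G a b t = proj₂ (proj₂ (proj₂ (isCube G)) a b) (faceLe⇒cubeLe (to G a) (to G b) t)

  above⇒ : ∀ G F (p : T (le K F G)) v → T (le K F (face G v)) → T (faceLe (to G (F , p)) v)
  above⇒ G F p v t = subst (λ w → T (faceLe (to G (F , p)) w)) (to-from G v) (order⇒ G (F , p) (from G v) t)

  above⇐ : ∀ G F (p : T (le K F G)) v → T (faceLe (to G (F , p)) v) → T (le K F (face G v))
  above⇐ G F p v t = order⇐ G (F , p) (from G v) (subst (λ w → T (faceLe (to G (F , p)) w)) (sym (to-from G v)) t)

  below⇒ : ∀ G F (p : T (le K F G)) v → T (le K (face G v) F) → T (faceLe v (to G (F , p)))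
  below⇒ G F p v t = subst (λ w → T (faceLe w (to G (F , p)))) (to-from G v) (order⇒ G (from G v) (F , p) t)

  below⇐ : ∀ G F (p : T (le K F G)) v → T (faceLe v (to G (F , p))) → T (le K (face G v) F)
  below⇐ G F p v t = order⇐ G (from G v) (F , p) (subst (λ w → T (faceLe w (to G (F , p)))) (sym (to-from G v)) t)

  Below-≡ : ∀ {G} (a b : Below K G) → proj₁ a ≡ proj₁ b → a ≡ b
  Below-≡ (x , p) (.x , q) refl = cong (x ,_) (T-irrelevant p q)

  #preimages : ∀ G F → sumL (allFaces (rank G)) (λ v → ind (does (F ≟ face G v))) ≡ ind (le K F G)
  #preimages G F with le K F G in eq
  ... | true = trans (sumL-cong (allFaces (rank G)) same) (Cube.sumFaces-delta (rank G) u)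
    where
    p : T (le K F G)
    p = true-T eq
    u = to G (F , p)
    same : ∀ v → ind (does (F ≟ face G v)) ≡ ind (does (v Cube.≟ u))
    same v with F ≟ face G v | v Cube.≟ u
    ... | yes _  | yes _   = refl
    ... | no _   | no _    = refl
    ... | yes F≡ | no v≢u  = ⊥-elim (v≢u (trans (sym (to-from G v)) (cong (to G) (sym (Below-≡ (F , p) (from G v) F≡)))))
    ... | no F≢ | yes refl = ⊥-elim (F≢ (sym (cong proj₁ (from-to G (F , p)))))
  ... | false = sumL-zero (allFaces (rank G)) _ none
    where
    none : ∀ v → ind (does (F ≟ face G v)) ≡ 0
    none v with F ≟ face G v
    ... | no _     = refl
    ... | yes refl = ⊥-elim (subst T eq (proj₂ (from G v)))

  transfer : ∀ G (q : Fin n → Bool) →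
    count n (λ F → le K F G ∧ q F) ≡ sumL (allFaces (rank G)) (λ v → ind (q (face G v)))
  transfer G q = sym (begin
    sumL V (λ v → ind (q (face G v)))
      ≡⟨ sumL-cong V (λ v → sym (trans (cong (ind (q (face G v)) *_) (one-face (face G v))) (ℕP.*-identityʳ _))) ⟩
    sumL V (λ v → ind (q (face G v)) * ΣF (λ F → ind (does (F ≟ face G v))))
      ≡⟨ sumL-cong V (λ v → sumL-*ˡ (allFin n) (ind (q (face G v))) _) ⟩
    sumL V (λ v → ΣF (λ F → ind (q (face G v)) * ind (does (F ≟ face G v))))
      ≡⟨ sumL-swap V (allFin n) _ ⟩
    ΣF (λ F → sumL V (λ v → ind (q (face G v)) * ind (does (F ≟ face G v))))
      ≡⟨ sumL-cong (allFin n) (λ F → trans (sumL-cong V (move F)) (sym (sumL-*ˡ V (ind (q F)) _))) ⟩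
    ΣF (λ F → ind (q F) * sumL V (λ v → ind (does (F ≟ face G v))))
      ≡⟨ sumL-cong (allFin n) (λ F → trans (cong (ind (q F) *_) (#preimages G F)) (trans (ℕP.*-comm (ind (q F)) _) (sym (ind-∧ (le K F G) (q F))))) ⟩
    ΣF (λ F → ind (le K F G ∧ q F))
      ≡⟨ cnt≡sumL _ (allFin n) ⟨
    count n (λ F → le K F G ∧ q F) ∎)
    where
    V = allFaces (rank G)
    ΣF : (Fin n → ℕ) → ℕ
    ΣF f = sumL (allFin n) f
    one-face : ∀ x → ΣF (λ F → ind (does (F ≟ x))) ≡ 1
    one-face x = sumL-unique _≟_ (allFin n) x (allFin⁺ n) (∈-allFin x)
    move : ∀ F v → ind (q (face G v)) * ind (does (F ≟ face G v)) ≡ ind (q F) * ind (does (F ≟ face G v))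
    move F v with F ≟ face G v
    ... | yes refl = refl
    ... | no _     = trans (ℕP.*-zeroʳ (ind (q (face G v)))) (sym (ℕP.*-zeroʳ (ind (q F))))

  3^-injective : ∀ a b → 3 ^ a ≡ 3 ^ b → a ≡ b
  3^-injective a b e with ℕP.<-cmp a b
  ... | tri≈ _ a≡b _ = a≡b
  ... | tri< a<b _ _ = ⊥-elim (ℕP.<-irrefl e (ℕP.^-monoʳ-< 3 (s≤s (s≤s z≤n)) a<b))
  ... | tri> _ _ b<a = ⊥-elim (ℕP.<-irrefl (sym e) (ℕP.^-monoʳ-< 3 (s≤s (s≤s z≤n)) b<a))

  -- the rank of a face y ≤ x is the dimension of its image in the cube of x:
  -- both count the faces below y as a power of 3
  rank≡cdim : ∀ x y (p : T (le K y x)) → rank y ≡ cdim (to x (y , p))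
  rank≡cdim x y p = 3^-injective _ _ (trans (sym via-y) via-x)
    where
    via-y : count n (λ F → le K F y) ≡ 3 ^ rank y
    via-y = trans (cnt-cong _ _ (allFin n) (λ F t → ∧-intro (le K F y) t tt) (λ F t → ∧-fst (le K F y) t))
                  (trans (transfer y (λ _ → true)) (Cube.#faces (rank y)))
    via-x : count n (λ F → le K F y) ≡ 3 ^ cdim (to x (y , p))
    via-x = trans (cnt-cong _ _ (allFin n) (λ F t → ∧-intro (le K F x) (transitive F y x t p) t) (λ F t → ∧-snd (le K F x) t))
            (trans (transfer x (λ F → le K F y))
            (trans (sumL-cong (allFaces (rank x)) (λ v → ind-cong _ _ (below⇒ x y p v) (below⇐ x y p v)))
            (Cube.#faces-below (rank x) (to x (y , p)))))

  rank-face : ∀ G v → rank (face G v) ≡ cdim v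
  rank-face G v = trans (rank≡cdim G (face G v) (proj₂ (from G v))) (cong cdim (to-from G v))

  -- a proper face has smaller dimension: its image in the cube of x is not ⋆⋯⋆
  strict : ∀ x y → T (le K y x) → y ≢ x → rank y < rank x
  strict x y p y≢x = subst (_< rank x) (sym (rank≡cdim x y p)) (ℕP.≤∧≢⇒< (cdim≤ u) not-top)
    where
    u = to x (y , p)
    x-top : to x (x , reflexive x) ≡ top (rank x)
    x-top = top-maximal _ (subst (λ w → T (faceLe w (to x (x , reflexive x)))) (to-from x (top (rank x)))
              (order⇒ x (from x (top (rank x))) (x , reflexive x) (proj₂ (from x (top (rank x))))))
    not-top : cdim u ≢ rank x
    not-top e = y≢x (cong proj₁ (begin
      (y , p)                           ≡⟨ from-to x (y , p) ⟨
      from x u                          ≡⟨ cong (from x) (trans (full-dim⇒top u e) (sym x-top)) ⟩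
      from x (to x (x , reflexive x))   ≡⟨ from-to x (x , reflexive x) ⟩
      (x , reflexive x)                 ∎))

  intervalRank : ∀ F G → T (le K F G) → ∀ t →
    count n (λ H → le K F H ∧ le K H G ∧ (rank H ≡ᵇ rank F + t)) ≡ bin (rank G ∸ rank F) t
  intervalRank F G F≤G t = begin
    count n (λ H → le K F H ∧ le K H G ∧ (rank H ≡ᵇ rank F + t))
      ≡⟨ cnt-cong _ _ (allFin n) reorder reorder⁻¹ ⟩
    count n (λ H → le K H G ∧ (le K F H ∧ (rank H ≡ᵇ rank F + t)))
      ≡⟨ transfer G (λ H → le K F H ∧ (rank H ≡ᵇ rank F + t)) ⟩
    sumL (allFaces (rank G)) (λ v → ind (le K F (face G v) ∧ (rank (face G v) ≡ᵇ rank F + t)))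
      ≡⟨ sumL-cong (allFaces (rank G)) (λ v → ind-cong _ _ (into-cube v) (from-cube v)) ⟩
    sumL (allFaces (rank G)) (λ v → ind (faceLe u v ∧ (cdim v ≡ᵇ cdim u + t)))
      ≡⟨ Cube.#faces-above (rank G) u t ⟩
    bin (rank G ∸ cdim u) t
      ≡⟨ cong (λ z → bin (rank G ∸ z) t) (rank≡cdim G F F≤G) ⟨
    bin (rank G ∸ rank F) t ∎
    where
    u = to G (F , F≤G)
    rF = rank≡cdim G F F≤G
    reorder : ∀ H → T (le K F H ∧ le K H G ∧ (rank H ≡ᵇ rank F + t)) → T (le K H G ∧ (le K F H ∧ (rank H ≡ᵇ rank F + t)))
    reorder H x = ∧-intro (le K H G) (∧-fst (le K H G) (∧-snd (le K F H) x))
                    (∧-intro (le K F H) (∧-fst (le K F H) x) (∧-snd (le K H G) (∧-snd (le K F H) x)))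
    reorder⁻¹ : ∀ H → T (le K H G ∧ (le K F H ∧ (rank H ≡ᵇ rank F + t))) → T (le K F H ∧ le K H G ∧ (rank H ≡ᵇ rank F + t))
    reorder⁻¹ H x = ∧-intro (le K F H) (∧-fst (le K F H) (∧-snd (le K H G) x))
                      (∧-intro (le K H G) (∧-fst (le K H G) x) (∧-snd (le K F H) (∧-snd (le K H G) x)))
    into-cube : ∀ v → T (le K F (face G v) ∧ (rank (face G v) ≡ᵇ rank F + t)) → T (faceLe u v ∧ (cdim v ≡ᵇ cdim u + t))
    into-cube v x = ∧-intro (faceLe u v) (above⇒ G F F≤G v (∧-fst (le K F (face G v)) x))
      (ℕP.≡⇒≡ᵇ (cdim v) (cdim u + t) (trans (sym (rank-face G v))
        (trans (ℕP.≡ᵇ⇒≡ (rank (face G v)) (rank F + t) (∧-snd (le K F (face G v)) x)) (cong (_+ t) rF))))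
    from-cube : ∀ v → T (faceLe u v ∧ (cdim v ≡ᵇ cdim u + t)) → T (le K F (face G v) ∧ (rank (face G v) ≡ᵇ rank F + t))
    from-cube v x = ∧-intro (le K F (face G v)) (above⇐ G F F≤G v (∧-fst (faceLe u v) x))
      (ℕP.≡⇒≡ᵇ (rank (face G v)) (rank F + t) (trans (rank-face G v)
        (trans (ℕP.≡ᵇ⇒≡ (cdim v) (cdim u + t) (∧-snd (faceLe u v) x)) (cong (_+ t) (sym rF)))))

  downRank : ∀ G s → count n (λ F → le K F G ∧ (rank F ≡ᵇ s)) ≡ bin (rank G) s * 2 ^ (rank G ∸ s)
  downRank G s = trans (transfer G (λ F → rank F ≡ᵇ s))
    (trans (sumL-cong (allFaces (rank G)) (λ v → cong (λ z → ind (z ≡ᵇ s)) (rank-face G v))) (Cube.#faces-of-dim (rank G) s))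

  isCubicalRank : IsCubicalRank K rank
  isCubicalRank = record
    { reflexive = reflexive ; transitive = transitive ; strict = strict
    ; intervalRank = intervalRank ; downRank = downRank }

-- Cubical barycentric subdivision preserves cubical ranks, the rank of an
-- interval [F,G] being r G - r F.

module SubdivisionRank {R : FaceRel} {r : Fin (size R) → ℕ} (isRank : CubicalRank.IsCubicalRank R r) where

  open import Data.Bool using (Bool; true; false; T; _∧_)
  open import Data.Bool.Properties using (∧-assoc)
  open import Data.Nat as ℕ using (ℕ; suc; _+_; _*_; _∸_; _^_; _≤_; _<_; _≡ᵇ_; _≤ᵇ_)
  import Data.Nat.Properties as ℕP
  open import Data.Fin using (Fin; _≟_)
  open import Data.List using (lookup; allFin; cartesianProduct)
  open import Data.List.Membership.Propositional.Properties using (∈-lookup; ∈-filter⁻)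
  open import Data.List.Relation.Unary.Unique.Propositional.Properties using (filter⁺; cartesianProduct⁺; allFin⁺)
  open import Relation.Binary.PropositionalEquality as ≡ using (_≡_; _≢_; refl; sym; trans; cong; cong₂)
  open import Data.Product using (_,_; _×_; proj₁; proj₂)
  open import Data.Sum using (_⊎_; inj₁; inj₂)
  open import Relation.Nullary using (yes; no; ¬_)
  open import Relation.Nullary.Decidable using (T?)
  open import Data.Empty using (⊥-elim)
  open Binomial using (bin; Σℕ; Σ-cong)
  open BinomialSums using (Σtrinomial)
  open Counting
  open Monus
  open CubicalRank using (IsCubicalRank)
  open IsCubicalRank isRank
  open CubicalRank.Properties isRank
  open ≡.≡-Reasoning

  private
    n = size R
    N = size (sdc R)

    ΣF : (Fin n → ℕ) → ℕ
    ΣF f = sumL (allFin n) f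

  interval : Fin N → Fin n × Fin n
  interval = lookup (intervals R)

  lower upper : Fin N → Fin n
  lower a = proj₁ (interval a)
  upper a = proj₂ (interval a)

  rank′ : Fin N → ℕ
  rank′ a = r (upper a) ∸ r (lower a)

  interval-≤ : ∀ a → T (le R (lower a) (upper a))
  interval-≤ a = proj₂ (∈-filter⁻ (λ p → T? (le R (proj₁ p) (proj₂ p))) {xs = cartesianProduct (allFin n) (allFin n)} (∈-lookup a))

  interval-injective : ∀ a b → interval a ≡ interval b → a ≡ b
  interval-injective = lookup-injective (intervals R) (filter⁺ _ (cartesianProduct⁺ (allFin⁺ n) (allFin⁺ n)))

  count-intervals : ∀ (P : Fin n × Fin n → Bool) →
    count N (λ a → P (interval a)) ≡ ΣF (λ H → ΣF (λ H' → ind (le R H H') * ind (P (H , H'))))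
  count-intervals P = begin
    count N (λ a → P (interval a))                                    ≡⟨ cnt≡sumL _ (allFin N) ⟩
    sumL (allFin N) (λ a → ind (P (interval a)))                      ≡⟨ sumL-positions (intervals R) (λ p → ind (P p)) ⟩
    sumL (intervals R) (λ p → ind (P p))                              ≡⟨ sumL-filter _ (cartesianProduct (allFin n) (allFin n)) _ ⟩
    sumL (cartesianProduct (allFin n) (allFin n)) (λ p → ind (le R (proj₁ p) (proj₂ p)) * ind (P p)) ≡⟨ sumL-cartesian (allFin n) (allFin n) _ ⟩
    ΣF (λ H → ΣF (λ H' → ind (le R H H') * ind (P (H , H'))))         ∎

  reflexive′ : ∀ x → T (le (sdc R) x x)
  reflexive′ x = ∧-intro (le R (lower x) (lower x)) (reflexive _) (reflexive _)

  transitive′ : ∀ x y z → T (le (sdc R) x y) → T (le (sdc R) y z) → T (le (sdc R) x z)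
  transitive′ x y z x≤y y≤z = ∧-intro (le R (lower z) (lower x))
    (transitive _ _ _ (∧-fst (le R (lower z) (lower y)) y≤z) (∧-fst (le R (lower y) (lower x)) x≤y))
    (transitive _ _ _ (∧-snd (le R (lower y) (lower x)) x≤y) (∧-snd (le R (lower z) (lower y)) y≤z))

  strict′ : ∀ x y → T (le (sdc R) y x) → y ≢ x → rank′ y < rank′ x
  strict′ x y y≤x y≢x = ∸-strict (monotone _ _ lx≤ly) (monotone _ _ (interval-≤ y)) (monotone _ _ uy≤ux) shrinks
    where
    lx≤ly = ∧-fst (le R (lower x) (lower y)) y≤x
    uy≤ux = ∧-snd (le R (lower x) (lower y)) y≤x
    shrinks : (r (lower x) < r (lower y)) ⊎ (r (upper y) < r (upper x))
    shrinks with lower x ≟ lower y | upper y ≟ upper x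
    ... | no lx≢ly | _        = inj₁ (strict _ _ lx≤ly lx≢ly)
    ... | yes _    | no uy≢ux = inj₂ (strict _ _ uy≤ux uy≢ux)
    ... | yes lx≡ly | yes uy≡ux = ⊥-elim (y≢x (interval-injective y x (cong₂ _,_ (sym lx≡ly) uy≡ux)))

  -- the subintervals of [F,G] of length s: choose the bottom H ∈ [F,G], then the top
  downRank′ : ∀ a s → count N (λ c → le (sdc R) c a ∧ (rank′ c ≡ᵇ s)) ≡ bin (rank′ a) s * 2 ^ (rank′ a ∸ s)
  downRank′ a s = begin
    count N (λ c → le (sdc R) c a ∧ (rank′ c ≡ᵇ s))
      ≡⟨ cnt-cong≡ _ _ (allFin N) (λ c → ∧-assoc (le R F (lower c)) _ _) ⟩
    count N (λ c → P (interval c))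
      ≡⟨ count-intervals P ⟩
    ΣF (λ H → ΣF (λ H' → ind (le R H H') * ind (P (H , H'))))
      ≡⟨ sumL-cong (allFin n) (λ H → sumL-factor (allFin n) (le R H) (le R F H) _) ⟩
    ΣF (λ H → ind (le R F H) * count n (λ H' → le R H H' ∧ (le R H' G ∧ (r H' ∸ r H ≡ᵇ s))))
      ≡⟨ sumL-cong (allFin n) (λ H → trans (cong (ind (le R F H) *_) (above-between H G s)) (merge H)) ⟩
    ΣF (λ H → ind (le R F H ∧ le R H G) * bin (r G ∸ r H) s)
      ≡⟨ sumL-fibres (allFin n) (λ H → le R F H ∧ le R H G) (λ H → r H ∸ r F) (λ H → bin (r G ∸ r H) s) m bound ⟩
    Σℕ (suc m) (λ α → ΣF (λ H → ind ((le R F H ∧ le R H G) ∧ (r H ∸ r F ≡ᵇ α)) * bin (r G ∸ r H) s))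
      ≡⟨ Binomial.Σ-cong≡ (suc m) fibre ⟩
    Σℕ (suc m) (λ α → bin m α * bin (m ∸ α) s)
      ≡⟨ Σtrinomial m s ⟩
    bin m s * 2 ^ (m ∸ s) ∎
    where
    F = lower a
    G = upper a
    m = rank′ a
    P : Fin n × Fin n → Bool
    P (H , H') = le R F H ∧ (le R H' G ∧ (r H' ∸ r H ≡ᵇ s))
    merge : ∀ H → ind (le R F H) * (ind (le R H G) * bin (r G ∸ r H) s) ≡ ind (le R F H ∧ le R H G) * bin (r G ∸ r H) s
    merge H = trans (sym (ℕP.*-assoc (ind (le R F H)) _ _)) (cong (_* bin (r G ∸ r H) s) (sym (ind-∧ (le R F H) (le R H G))))
    bound : ∀ H → T (le R F H ∧ le R H G) → r H ∸ r F ≤ m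
    bound H t = ℕP.∸-monoˡ-≤ (r F) (monotone _ _ (∧-snd (le R F H) t))
    -- the bottoms H at distance α from F; each leaves C(m - α, s) tops
    fibre : ∀ α → ΣF (λ H → ind ((le R F H ∧ le R H G) ∧ (r H ∸ r F ≡ᵇ α)) * bin (r G ∸ r H) s) ≡ bin m α * bin (m ∸ α) s
    fibre α = trans (sumL-const (allFin n) _ _ (bin (m ∸ α) s) remaining) (cong (_* bin (m ∸ α) s) bottoms)
      where
      remaining : ∀ H → T ((le R F H ∧ le R H G) ∧ (r H ∸ r F ≡ᵇ α)) → bin (r G ∸ r H) s ≡ bin (m ∸ α) s
      remaining H t = cong (λ z → bin z s) (trans (∸-difference (monotone _ _ F≤H) (monotone _ _ H≤G))
                        (cong (m ∸_) (ℕP.≡ᵇ⇒≡ (r H ∸ r F) α (∧-snd (le R F H ∧ le R H G) t))))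
        where
        F≤H = ∧-fst (le R F H) (∧-fst (le R F H ∧ le R H G) t)
        H≤G = ∧-snd (le R F H) (∧-fst (le R F H ∧ le R H G) t)
      bottoms : cnt (λ H → (le R F H ∧ le R H G) ∧ (r H ∸ r F ≡ᵇ α)) (allFin n) ≡ bin m α
      bottoms = trans (cnt-cong≡ _ _ (allFin n) (λ H → ∧-assoc (le R F H) _ _))
                  (trans (above-between F G α) (trans (cong (_* bin m α) (ind-true (interval-≤ a))) (ℕP.*-identityˡ _)))

  private
    shuffle : ∀ a b c d x → (a ∧ b) ∧ ((c ∧ d) ∧ x) ≡ (c ∧ a) ∧ (b ∧ (d ∧ x))
    shuffle true  true  true  d x = refl
    shuffle true  true  false d x = refl
    shuffle true  false true  d x = refl
    shuffle true  false false d x = refl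
    shuffle false b     true  d x = refl
    shuffle false b     false d x = refl

  -- The intervals between [F,G] ⊆ [F',G'] longer by t: choose the bottom H ∈ [F',F],
  -- at distance α from F, then the top H' ∈ [G,G'] at distance t - α from G.
  module Between (a b : Fin N) (a≤b : T (le (sdc R) a b)) (t : ℕ) where

    F = lower a
    G = upper a
    F′ = lower b
    G′ = upper b
    F′≤F = ∧-fst (le R F′ F) a≤b
    G≤G′ = ∧-snd (le R F′ F) a≤b
    F≤G = interval-≤ a
    d₀ = r G ∸ r F
    d₁ = r F ∸ r F′
    d₂ = r G′ ∸ r G

    Bottom : Fin n → Bool
    Bottom H = le R F′ H ∧ le R H F

    Top : Fin n → Fin n → Bool
    Top H H′ = le R G H′ ∧ (le R H′ G′ ∧ (r H′ ∸ r H ≡ᵇ d₀ + t))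

    tops : ℕ → ℕ
    tops α = ind (α ≤ᵇ t) * bin d₂ (t ∸ α)

    tops-count : ∀ H → T (Bottom H) → count n (λ H′ → le R H H′ ∧ Top H H′) ≡ tops (r F ∸ r H)
    tops-count H bottom with r F ∸ r H ℕP.≤? t
    ... | yes α≤t = trans (cnt-cong _ _ (allFin n) fw bw)
          (trans (above-between G G′ (t ∸ α)) (cong (_* bin d₂ (t ∸ α)) (trans (ind-true G≤G′) (sym (ind-true (ℕP.≤⇒≤ᵇ α≤t))))))
      where
      α = r F ∸ r H
      H≤F = ∧-snd (le R F′ H) bottom
      fw : ∀ H′ → T (le R H H′ ∧ Top H H′) → T (le R G H′ ∧ (le R H′ G′ ∧ (r H′ ∸ r G ≡ᵇ t ∸ α)))
      fw H′ x = ∧-intro (le R G H′) G≤H′ (∧-intro (le R H′ G′) (∧-fst (le R H′ G′) rest′)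
                  (ℕP.≡⇒≡ᵇ (r H′ ∸ r G) (t ∸ α) (≡.subst (λ z → r H′ ∸ r G ≡ z ∸ α) ends (sym (ℕP.m+n∸m≡n α (r H′ ∸ r G))))))
        where
        rest = ∧-snd (le R H H′) x
        G≤H′ = ∧-fst (le R G H′) rest
        rest′ = ∧-snd (le R G H′) rest
        ends : α + (r H′ ∸ r G) ≡ t
        ends = ∸-extension⇒ (monotone _ _ H≤F) (monotone _ _ F≤G) (monotone _ _ G≤H′)
                 (ℕP.≡ᵇ⇒≡ (r H′ ∸ r H) (d₀ + t) (∧-snd (le R H′ G′) rest′))
      bw : ∀ H′ → T (le R G H′ ∧ (le R H′ G′ ∧ (r H′ ∸ r G ≡ᵇ t ∸ α))) → T (le R H H′ ∧ Top H H′)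
      bw H′ x = ∧-intro (le R H H′) (transitive H F H′ H≤F (transitive F G H′ F≤G G≤H′))
                  (∧-intro (le R G H′) G≤H′ (∧-intro (le R H′ G′) (∧-fst (le R H′ G′) rest)
                    (ℕP.≡⇒≡ᵇ (r H′ ∸ r H) (d₀ + t) (∸-extension⇐ (monotone _ _ H≤F) (monotone _ _ F≤G) (monotone _ _ G≤H′) ends))))
        where
        G≤H′ = ∧-fst (le R G H′) x
        rest = ∧-snd (le R G H′) x
        ends : α + (r H′ ∸ r G) ≡ t
        ends = trans (cong (α +_) (ℕP.≡ᵇ⇒≡ (r H′ ∸ r G) (t ∸ α) (∧-snd (le R H′ G′) rest))) (ℕP.m+[n∸m]≡n α≤t)
    ... | no α≰t = trans (cnt-zero _ (allFin n) too-far) (sym (cong (_* bin d₂ (t ∸ α)) (ind-false (λ α≤t → α≰t (ℕP.≤ᵇ⇒≤ α t α≤t)))))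
      where
      α = r F ∸ r H
      H≤F = ∧-snd (le R F′ H) bottom
      too-far : ∀ H′ → ¬ T (le R H H′ ∧ Top H H′)
      too-far H′ x = α≰t (≡.subst (α ≤_) ends (ℕP.m≤m+n α (r H′ ∸ r G)))
        where
        rest = ∧-snd (le R H H′) x
        G≤H′ = ∧-fst (le R G H′) rest
        ends : α + (r H′ ∸ r G) ≡ t
        ends = ∸-extension⇒ (monotone _ _ H≤F) (monotone _ _ F≤G) (monotone _ _ G≤H′)
                 (ℕP.≡ᵇ⇒≡ (r H′ ∸ r H) (d₀ + t) (∧-snd (le R H′ G′) (∧-snd (le R G H′) rest)))

    fibre : ∀ α → α < suc d₁ → ΣF (λ H → ind (Bottom H ∧ (r F ∸ r H ≡ᵇ α)) * tops (r F ∸ r H)) ≡ bin d₁ α * tops α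
    fibre α α<1+d₁ = trans (sumL-const (allFin n) _ _ (tops α) same-tops) (cong (_* tops α) bottoms)
      where
      same-tops : ∀ H → T (Bottom H ∧ (r F ∸ r H ≡ᵇ α)) → tops (r F ∸ r H) ≡ tops α
      same-tops H x = cong tops (ℕP.≡ᵇ⇒≡ (r F ∸ r H) α (∧-snd (Bottom H) x))
      bottoms : cnt (λ H → Bottom H ∧ (r F ∸ r H ≡ᵇ α)) (allFin n) ≡ bin d₁ α
      bottoms = trans (cnt-cong≡ _ _ (allFin n) (λ H → ∧-assoc (le R F′ H) _ _)) (below-between F′ F F′≤F α (ℕP.≤-pred α<1+d₁))

    lengths : rank′ b ∸ rank′ a ≡ d₁ + d₂
    lengths = trans (cong (_∸ d₀) (∸-chain (monotone _ _ F′≤F) (monotone _ _ F≤G) (monotone _ _ G≤G′))) (ℕP.m+n∸m≡n d₀ (d₁ + d₂))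

    count-between : count N (λ c → le (sdc R) a c ∧ (le (sdc R) c b ∧ (rank′ c ≡ᵇ rank′ a + t))) ≡ bin (rank′ b ∸ rank′ a) t
    count-between = begin
      count N (λ c → le (sdc R) a c ∧ (le (sdc R) c b ∧ (rank′ c ≡ᵇ rank′ a + t)))
        ≡⟨ cnt-cong≡ _ _ (allFin N) (λ c → shuffle (le R (lower c) F) (le R G (upper c))
              (le R F′ (lower c)) (le R (upper c) G′) (rank′ c ≡ᵇ rank′ a + t)) ⟩
      count N (λ c → Q (interval c))
        ≡⟨ count-intervals Q ⟩
      ΣF (λ H → ΣF (λ H′ → ind (le R H H′) * ind (Q (H , H′))))
        ≡⟨ sumL-cong (allFin n) (λ H → sumL-factor (allFin n) (le R H) (Bottom H) (Top H)) ⟩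
      ΣF (λ H → ind (Bottom H) * count n (λ H′ → le R H H′ ∧ Top H H′))
        ≡⟨ sumL-on-support (allFin n) Bottom _ _ tops-count ⟩
      ΣF (λ H → ind (Bottom H) * tops (r F ∸ r H))
        ≡⟨ sumL-fibres (allFin n) Bottom (λ H → r F ∸ r H) (λ H → tops (r F ∸ r H)) d₁ bound ⟩
      Σℕ (suc d₁) (λ α → ΣF (λ H → ind (Bottom H ∧ (r F ∸ r H ≡ᵇ α)) * tops (r F ∸ r H)))
        ≡⟨ Σ-cong (suc d₁) fibre ⟩
      Σℕ (suc d₁) (λ α → bin d₁ α * tops α)
        ≡⟨ vandermonde-truncated d₁ d₂ t ⟩
      bin (d₁ + d₂) t
        ≡⟨ cong (λ z → bin z t) lengths ⟨
      bin (rank′ b ∸ rank′ a) t ∎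
      where
      Q : Fin n × Fin n → Bool
      Q (H , H′) = Bottom H ∧ Top H H′
      bound : ∀ H → T (Bottom H) → r F ∸ r H ≤ d₁
      bound H x = ℕP.∸-monoʳ-≤ (r F) (monotone _ _ (∧-fst (le R F′ H) x))

  intervalRank′ : ∀ a b → T (le (sdc R) a b) → ∀ t →
    count N (λ c → le (sdc R) a c ∧ le (sdc R) c b ∧ (rank′ c ≡ᵇ rank′ a + t)) ≡ bin (rank′ b ∸ rank′ a) t
  intervalRank′ a b a≤b t = Between.count-between a b a≤b t

  isCubicalRank′ : IsCubicalRank (sdc R) rank′
  isCubicalRank′ = record
    { reflexive = reflexive′ ; transitive = transitive′ ; strict = strict′
    ; intervalRank = intervalRank′ ; downRank = downRank′ }

  rank′≤ : ∀ e → (∀ x → r x ≤ e) → ∀ a → rank′ a ≤ e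
  rank′≤ e bounded a = ℕP.≤-trans (ℕP.m∸n≤m (r (upper a)) (r (lower a))) (bounded _)

  -- f_j(sd_c R): the intervals [F,G] of length j, grouped by the dimension i of G
  fvec-sdc : ∀ e → (∀ x → r x ≤ e) → ∀ j → fvec (sdc R) j ≡ Σℕ (suc e) (λ i → fvec R i * (bin i j * 2 ^ j))
  fvec-sdc e bounded j = begin
    fvec (sdc R) j
      ≡⟨ CubicalRank.Properties.fvec≡count isCubicalRank′ j ⟩
    count N (λ a → rank′ a ≡ᵇ j)
      ≡⟨ count-intervals (λ p → r (proj₂ p) ∸ r (proj₁ p) ≡ᵇ j) ⟩
    ΣF (λ F → ΣF (λ G → ind (le R F G) * ind (r G ∸ r F ≡ᵇ j)))
      ≡⟨ sumL-swap (allFin n) (allFin n) _ ⟩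
    ΣF (λ G → ΣF (λ F → ind (le R F G) * ind (r G ∸ r F ≡ᵇ j)))
      ≡⟨ sumL-cong (allFin n) below-G ⟩
    ΣF (λ G → ind true * (bin (r G) j * 2 ^ j))
      ≡⟨ sumL-fibres (allFin n) (λ _ → true) r (λ G → bin (r G) j * 2 ^ j) e (λ x _ → bounded x) ⟩
    Σℕ (suc e) (λ i → ΣF (λ G → ind (r G ≡ᵇ i) * (bin (r G) j * 2 ^ j)))
      ≡⟨ Binomial.Σ-cong≡ (suc e) (λ i → sumL-const (allFin n) _ _ (bin i j * 2 ^ j)
           (λ G x → cong (λ z → bin z j * 2 ^ j) (ℕP.≡ᵇ⇒≡ (r G) i x))) ⟩
    Σℕ (suc e) (λ i → count n (λ G → r G ≡ᵇ i) * (bin i j * 2 ^ j))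
      ≡⟨ Binomial.Σ-cong≡ (suc e) (λ i → cong (_* (bin i j * 2 ^ j)) (sym (fvec≡count i))) ⟩
    Σℕ (suc e) (λ i → fvec R i * (bin i j * 2 ^ j)) ∎
    where
    below-G : ∀ G → ΣF (λ F → ind (le R F G) * ind (r G ∸ r F ≡ᵇ j)) ≡ ind true * (bin (r G) j * 2 ^ j)
    below-G G = trans (sumL-cong (allFin n) (λ F → sym (ind-∧ (le R F G) _)))
                  (trans (sym (cnt≡sumL _ (allFin n))) (trans (below-count G j) (sym (ℕP.+-identityʳ _))))

module Polynomials where

  open import Data.Nat as ℕ using (zero; suc; _∸_)
  import Data.Nat.Properties as ℕP
  open import Data.Integer as ℤ using (ℤ; +_; _+_; _*_; -_)
  import Data.Integer.Properties as ℤP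
  open import Data.List using ([]; _∷_; map; foldr; applyUpTo)
  open import Relation.Binary.PropositionalEquality as ≡ using (_≡_; _≢_; refl; sym; trans; cong; cong₂)
  open import Data.Empty using (⊥-elim)
  open import Data.Integer.Tactic.RingSolver using (solve-∀)
  open Binomial using (bin)
  open ≡.≡-Reasoning

  open FiniteSums ℤP.+-*-commutativeSemiring public renaming (Σ< to Σℤ)

  coeff-padd : ∀ p q i → coeff (padd p q) i ≡ coeff p i + coeff q i
  coeff-padd []      q       i       = sym (ℤP.+-identityˡ _)
  coeff-padd (a ∷ p) []      i       = sym (ℤP.+-identityʳ _)
  coeff-padd (a ∷ p) (b ∷ q) zero    = refl
  coeff-padd (a ∷ p) (b ∷ q) (suc i) = coeff-padd p q i

  coeff-pscale : ∀ c p i → coeff (pscale c p) i ≡ c * coeff p i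
  coeff-pscale c []      i       = sym (ℤP.*-zeroʳ c)
  coeff-pscale c (a ∷ p) zero    = refl
  coeff-pscale c (a ∷ p) (suc i) = coeff-pscale c p i

  coeff-pmul : ∀ p q i → coeff (pmul p q) i ≡ Σℤ (suc i) (λ a → coeff p a * coeff q (i ∸ a))
  coeff-pmul []      q i = sym (Σ-zero (suc i) _ (λ a _ → ℤP.*-zeroˡ (coeff q (i ∸ a))))
  coeff-pmul (a ∷ p) q zero = begin
    coeff (pmul (a ∷ p) q) 0   ≡⟨ coeff-padd (pscale a q) _ 0 ⟩
    coeff (pscale a q) 0 + + 0 ≡⟨ ℤP.+-identityʳ _ ⟩
    coeff (pscale a q) 0       ≡⟨ coeff-pscale a q 0 ⟩
    a * coeff q 0              ≡⟨ ℤP.+-identityˡ _ ⟨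
    + 0 + a * coeff q 0        ∎
  coeff-pmul (a ∷ p) q (suc i) = begin
    coeff (padd (pscale a q) (+ 0 ∷ pmul p q)) (suc i)                  ≡⟨ coeff-padd (pscale a q) _ (suc i) ⟩
    coeff (pscale a q) (suc i) + coeff (pmul p q) i                     ≡⟨ cong₂ _+_ (coeff-pscale a q (suc i)) (coeff-pmul p q i) ⟩
    a * coeff q (suc i) + Σℤ (suc i) (λ t → coeff p t * coeff q (i ∸ t)) ≡⟨ Σ-shift (suc i) _ ⟨
    Σℤ (suc (suc i)) (λ t → coeff (a ∷ p) t * coeff q (suc i ∸ t))     ∎

  coeff-linear₀ : ∀ c₀ c₁ p → coeff (pmul (c₀ ∷ c₁ ∷ []) p) 0 ≡ c₀ * coeff p 0
  coeff-linear₀ c₀ c₁ p = trans (coeff-padd (pscale c₀ p) _ 0) (trans (cong (_+ + 0) (coeff-pscale c₀ p 0)) (ℤP.+-identityʳ _))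

  coeff-linear : ∀ c₀ c₁ p k → coeff (pmul (c₀ ∷ c₁ ∷ []) p) (suc k) ≡ c₀ * coeff p (suc k) + c₁ * coeff p k
  coeff-linear c₀ c₁ p k = trans (coeff-padd (pscale c₀ p) _ (suc k)) (cong₂ _+_ (coeff-pscale c₀ p (suc k))
    (trans (coeff-padd (pscale c₁ p) _ k) (trans (cong₂ _+_ (coeff-pscale c₁ p k) (coeff-zero k)) (ℤP.+-identityʳ _))))
    where
    coeff-zero : ∀ k → coeff (+ 0 ∷ []) k ≡ + 0
    coeff-zero zero    = refl
    coeff-zero (suc k) = refl

  2x 1-x 1+x : Poly
  2x  = + 0 ∷ + 2 ∷ []
  1-x = + 1 ∷ - (+ 1) ∷ []
  1+x = + 1 ∷ + 1 ∷ []

  sgn : ℕ.ℕ → ℤ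
  sgn zero    = + 1
  sgn (suc k) = - sgn k

  coeff-2x^-diagonal : ∀ j → coeff (ppow 2x j) j ≡ + (2 ℕ.^ j)
  coeff-2x^-diagonal zero    = refl
  coeff-2x^-diagonal (suc j) = begin
    coeff (pmul 2x (ppow 2x j)) (suc j)                    ≡⟨ coeff-linear (+ 0) (+ 2) (ppow 2x j) j ⟩
    + 0 * coeff (ppow 2x j) (suc j) + + 2 * coeff (ppow 2x j) j ≡⟨ ℤP.+-identityˡ _ ⟩
    + 2 * coeff (ppow 2x j) j                              ≡⟨ cong (+ 2 *_) (coeff-2x^-diagonal j) ⟩
    + 2 * + (2 ℕ.^ j)                                      ≡⟨ ℤP.pos-* 2 (2 ℕ.^ j) ⟨
    + (2 ℕ.^ suc j)                                        ∎

  coeff-2x^-off : ∀ j k → j ≢ k → coeff (ppow 2x j) k ≡ + 0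
  coeff-2x^-off zero    zero    j≢k = ⊥-elim (j≢k refl)
  coeff-2x^-off zero    (suc k) j≢k = refl
  coeff-2x^-off (suc j) zero    j≢k = coeff-linear₀ (+ 0) (+ 2) (ppow 2x j)
  coeff-2x^-off (suc j) (suc k) j≢k = trans (coeff-linear (+ 0) (+ 2) (ppow 2x j) k)
    (trans (ℤP.+-identityˡ _) (cong (+ 2 *_) (coeff-2x^-off j k (λ j≡k → j≢k (cong suc j≡k)))))

  coeff-1-x^ : ∀ t k → coeff (ppow 1-x t) k ≡ sgn k * + bin t k
  coeff-1-x^ zero    zero    = refl
  coeff-1-x^ zero    (suc k) = sym (ℤP.*-zeroʳ (sgn (suc k)))
  coeff-1-x^ (suc t) zero    = trans (coeff-linear₀ (+ 1) (- (+ 1)) (ppow 1-x t)) (trans (ℤP.*-identityˡ _) (coeff-1-x^ t 0))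
  coeff-1-x^ (suc t) (suc k) = begin
    coeff (pmul 1-x (ppow 1-x t)) (suc k)
      ≡⟨ coeff-linear (+ 1) (- (+ 1)) (ppow 1-x t) k ⟩
    + 1 * coeff (ppow 1-x t) (suc k) + - (+ 1) * coeff (ppow 1-x t) k
      ≡⟨ cong₂ (λ a b → + 1 * a + - (+ 1) * b) (coeff-1-x^ t (suc k)) (coeff-1-x^ t k) ⟩
    + 1 * (- sgn k * + bin t (suc k)) + - (+ 1) * (sgn k * + bin t k)
      ≡⟨ pascal (sgn k) (+ bin t (suc k)) (+ bin t k) ⟩
    - sgn k * (+ bin t k + + bin t (suc k))
      ≡⟨ cong (- sgn k *_) (ℤP.pos-+ (bin t k) (bin t (suc k))) ⟨
    - sgn k * + (bin t k ℕ.+ bin t (suc k)) ∎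
    where
    pascal : ∀ s a b → + 1 * (- s * a) + - (+ 1) * (s * b) ≡ - s * (b + a)
    pascal = solve-∀

  coeff-1+x^ : ∀ e k → coeff (ppow 1+x e) k ≡ + bin e k
  coeff-1+x^ zero    zero    = refl
  coeff-1+x^ zero    (suc k) = refl
  coeff-1+x^ (suc e) zero    = trans (coeff-linear₀ (+ 1) (+ 1) (ppow 1+x e)) (trans (ℤP.*-identityˡ _) (coeff-1+x^ e 0))
  coeff-1+x^ (suc e) (suc k) = begin
    coeff (pmul 1+x (ppow 1+x e)) (suc k)                         ≡⟨ coeff-linear (+ 1) (+ 1) (ppow 1+x e) k ⟩
    + 1 * coeff (ppow 1+x e) (suc k) + + 1 * coeff (ppow 1+x e) k ≡⟨ cong₂ (λ a b → + 1 * a + + 1 * b) (coeff-1+x^ e (suc k)) (coeff-1+x^ e k) ⟩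
    + 1 * + bin e (suc k) + + 1 * + bin e k                       ≡⟨ pascal (+ bin e (suc k)) (+ bin e k) ⟩
    + bin e k + + bin e (suc k)                                   ≡⟨ ℤP.pos-+ (bin e k) (bin e (suc k)) ⟨
    + (bin e k ℕ.+ bin e (suc k))                                 ∎
    where
    pascal : ∀ a b → + 1 * a + + 1 * b ≡ b + a
    pascal = solve-∀

  coeff-sum : ∀ n (g : ℕ.ℕ → Poly) (h : ℕ.ℕ → ℕ.ℕ) i →
    coeff (foldr padd [] (map g (applyUpTo h n))) i ≡ Σℤ n (λ j → coeff (g (h j)) i)
  coeff-sum zero    g h i = refl
  coeff-sum (suc n) g h i = trans (coeff-padd (g (h 0)) _ i)
    (trans (cong (λ z → coeff (g (h 0)) i + z) (coeff-sum n g (λ j → h (suc j)) i)) (sym (Σ-shift n _)))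

module SignedBinomialSums where

  open import Data.Nat as ℕ using (ℕ; zero; suc; _∸_; _≤_; _<_; s≤s)
  import Data.Nat.Properties as ℕP
  open import Data.Integer as ℤ using (ℤ; +_; _+_; _*_; -_)
  import Data.Integer.Properties as ℤP
  open import Relation.Binary.PropositionalEquality as ≡ using (_≡_; _≢_; refl; sym; trans; cong; cong₂)
  open import Relation.Nullary using (yes; no)
  open import Data.Integer.Tactic.RingSolver using (solve-∀)
  open Binomial using (bin; bin->; bin-nn; trinomial)
  open Polynomials using (Σℤ; Σ-cong≡; Σ-zero; Σ-*ˡ; Σ-window; ι; sgn)
  open BinomialTheorem ℤP.+-*-commutativeSemiring using (binomial) renaming (_^_ to pow)
  open ≡.≡-Reasoning

  ι≡+ : ∀ m → ι m ≡ + m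
  ι≡+ zero    = refl
  ι≡+ (suc m) = cong (λ z → + 1 + z) (ι≡+ m)

  pow-1 : ∀ k → pow (+ 1) k ≡ + 1
  pow-1 zero    = refl
  pow-1 (suc k) = cong (+ 1 *_) (pow-1 k)

  pow-2 : ∀ j → pow (+ 2) j ≡ + (2 ℕ.^ j)
  pow-2 zero    = refl
  pow-2 (suc j) = trans (cong (+ 2 *_) (pow-2 j)) (sym (ℤP.pos-* 2 (2 ℕ.^ j)))

  pow-minus-1 : ∀ k → pow (- (+ 1)) k ≡ sgn k
  pow-minus-1 zero    = refl
  pow-minus-1 (suc k) = trans (cong (- (+ 1) *_) (pow-minus-1 k)) (ℤP.-1*i≡-i (sgn k))

  -- Σ_j C(i,j) 2^j (-1)^(i-j) = (2 - 1)^i = 1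
  alternating-sum : ∀ i → Σℤ (suc i) (λ j → + bin i j * (+ (2 ℕ.^ j) * sgn (i ∸ j))) ≡ + 1
  alternating-sum i = begin
    Σℤ (suc i) (λ j → + bin i j * (+ (2 ℕ.^ j) * sgn (i ∸ j)))
      ≡⟨ Σ-cong≡ (suc i) (λ j → sym (cong₂ _*_ (ι≡+ (bin i j)) (cong₂ _*_ (pow-2 j) (pow-minus-1 (i ∸ j))))) ⟩
    Σℤ (suc i) (λ j → ι (bin i j) * (pow (+ 2) j * pow (- (+ 1)) (i ∸ j)))
      ≡⟨ binomial i (+ 2) (- (+ 1)) ⟨
    pow (+ 2 + - (+ 1)) i
      ≡⟨ pow-1 i ⟩
    + 1 ∎

  -- the (i,j) entry of (Pascal matrix)⁻¹ · (Pascal matrix), summed over k ≤ e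
  pascal-inverse : ℕ → ℕ → ℕ → ℤ
  pascal-inverse e i j = Σℤ (suc e) (λ k → (+ bin i k * sgn (i ∸ k)) * + bin k j)

  private
    pascal-inverse-window : ∀ e i j → j ≤ i → i ≤ e → pascal-inverse e i j ≡ + bin i j * pow (+ 1 + - (+ 1)) (i ∸ j)
    pascal-inverse-window e i j j≤i i≤e = begin
      pascal-inverse e i j
        ≡⟨ Σ-window g j i (suc e) j≤i (s≤s i≤e) below above ⟩
      Σℤ (suc (i ∸ j)) (λ a → g (j ℕ.+ a))
        ≡⟨ Σ-cong≡ (suc (i ∸ j)) shifted ⟩
      Σℤ (suc (i ∸ j)) (λ a → + bin i j * (ι (bin (i ∸ j) a) * (pow (+ 1) a * pow (- (+ 1)) ((i ∸ j) ∸ a))))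
        ≡⟨ Σ-*ˡ (suc (i ∸ j)) (+ bin i j) _ ⟨
      + bin i j * Σℤ (suc (i ∸ j)) (λ a → ι (bin (i ∸ j) a) * (pow (+ 1) a * pow (- (+ 1)) ((i ∸ j) ∸ a)))
        ≡⟨ cong (+ bin i j *_) (binomial (i ∸ j) (+ 1) (- (+ 1))) ⟨
      + bin i j * pow (+ 1 + - (+ 1)) (i ∸ j) ∎
      where
      g : ℕ → ℤ
      g k = (+ bin i k * sgn (i ∸ k)) * + bin k j
      below : ∀ k → k < j → g k ≡ + 0
      below k k<j = trans (cong (λ t → (+ bin i k * sgn (i ∸ k)) * + t) (bin-> k j k<j)) (ℤP.*-zeroʳ (+ bin i k * sgn (i ∸ k)))
      above : ∀ k → i < k → k < suc e → g k ≡ + 0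
      above k i<k _ = cong (λ t → (+ t * sgn (i ∸ k)) * + bin k j) (bin-> i k i<k)
      shifted : ∀ a → g (j ℕ.+ a) ≡ + bin i j * (ι (bin (i ∸ j) a) * (pow (+ 1) a * pow (- (+ 1)) ((i ∸ j) ∸ a)))
      shifted a = begin
        (+ bin i (j ℕ.+ a) * sgn (i ∸ (j ℕ.+ a))) * + bin (j ℕ.+ a) j
          ≡⟨ regroup (+ bin i (j ℕ.+ a)) (sgn (i ∸ (j ℕ.+ a))) (+ bin (j ℕ.+ a) j) ⟩
        (+ bin i (j ℕ.+ a) * + bin (j ℕ.+ a) j) * sgn (i ∸ (j ℕ.+ a))
          ≡⟨ cong₂ _*_ (trans (sym (ℤP.pos-* (bin i (j ℕ.+ a)) _)) (trans (cong +_ (trinomial i j a)) (ℤP.pos-* (bin i j) _)))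
             (cong sgn (sym (ℕP.∸-+-assoc i j a))) ⟩
        (+ bin i j * + bin (i ∸ j) a) * sgn ((i ∸ j) ∸ a)
          ≡⟨ cong₂ (λ x y → (+ bin i j * x) * y) (sym (ι≡+ (bin (i ∸ j) a))) (sym (pow-minus-1 ((i ∸ j) ∸ a))) ⟩
        (+ bin i j * ι (bin (i ∸ j) a)) * pow (- (+ 1)) ((i ∸ j) ∸ a)
          ≡⟨ cong ((+ bin i j * ι (bin (i ∸ j) a)) *_) (ℤP.*-identityˡ _) ⟨
        (+ bin i j * ι (bin (i ∸ j) a)) * (+ 1 * pow (- (+ 1)) ((i ∸ j) ∸ a))
          ≡⟨ cong (λ z → (+ bin i j * ι (bin (i ∸ j) a)) * (z * pow (- (+ 1)) ((i ∸ j) ∸ a))) (sym (pow-1 a)) ⟩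
        (+ bin i j * ι (bin (i ∸ j) a)) * (pow (+ 1) a * pow (- (+ 1)) ((i ∸ j) ∸ a))
          ≡⟨ ℤP.*-assoc (+ bin i j) _ _ ⟩
        + bin i j * (ι (bin (i ∸ j) a) * (pow (+ 1) a * pow (- (+ 1)) ((i ∸ j) ∸ a))) ∎
        where
        regroup : ∀ x y z → (x * y) * z ≡ (x * z) * y
        regroup = solve-∀

  pascal-inverse-diagonal : ∀ e j → j ≤ e → pascal-inverse e j j ≡ + 1
  pascal-inverse-diagonal e j j≤e = trans (pascal-inverse-window e j j ℕP.≤-refl j≤e)
    (cong₂ (λ a b → + a * pow (+ 1 + - (+ 1)) b) (bin-nn j) (ℕP.n∸n≡0 j))

  pascal-inverse-off : ∀ e i j → i ≤ e → i ≢ j → pascal-inverse e i j ≡ + 0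
  pascal-inverse-off e i j i≤e i≢j with j ℕP.≤? i
  ... | no j≰i = Σ-zero (suc e) _ vanish
    where
    vanish : ∀ k → k < suc e → (+ bin i k * sgn (i ∸ k)) * + bin k j ≡ + 0
    vanish k _ with k ℕP.≤? i
    ... | yes k≤i = trans (cong (λ t → (+ bin i k * sgn (i ∸ k)) * + t) (bin-> k j (ℕP.≤-<-trans k≤i (ℕP.≰⇒> j≰i))))
                          (ℤP.*-zeroʳ (+ bin i k * sgn (i ∸ k)))
    ... | no k≰i  = cong (λ t → (+ t * sgn (i ∸ k)) * + bin k j) (bin-> i k (ℕP.≰⇒> k≰i))
  ... | yes j≤i = trans (pascal-inverse-window e i j j≤i i≤e)
      (trans (cong (λ z → + bin i j * pow (+ 1 + - (+ 1)) z) (ℕP.+-∸-assoc 1 j<i)) (ℤP.*-zeroʳ (+ bin i j)))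
    where
    j<i : j < i
    j<i = ℕP.≤∧≢⇒< j≤i (λ j≡i → i≢j (sym j≡i))

-- Coefficients of the short cubical h-polynomial and of the limit polynomial.
--   [x^i] h^(sc)_R = Σ_{j ≤ e} f_j(R) w(e,i,j),  w(e,i,j) = [x^i] (2x)^j (1-x)^(e-j),
-- and the top row of the binomial transform is  Σ_j C(e,j) w(e,i,j) = C(e,i),
-- i.e.  Σ_j C(e,j) (2x)^j (1-x)^(e-j) = (1+x)^e.

module HPolynomial where

  open import Data.Nat as ℕ using (ℕ; suc; _∸_; _≤_; _<_; s≤s)
  import Data.Nat.Properties as ℕP
  open import Data.Integer as ℤ using (ℤ; +_; _+_; _*_)
  import Data.Integer.Properties as ℤP
  open import Relation.Binary.PropositionalEquality as ≡ using (_≡_; sym; trans; cong; cong₂)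
  open import Relation.Nullary using (yes; no)
  open import Data.Integer.Tactic.RingSolver using (solve-∀)
  open Binomial using (bin; bin->; trinomial)
  open Polynomials
  open SignedBinomialSums using (alternating-sum)
  open ≡.≡-Reasoning

  w : ℕ → ℕ → ℕ → ℤ
  w e i j = coeff (pmul (ppow 2x j) (ppow 1-x (e ∸ j))) i

  w-≤ : ∀ e i j → j ≤ i → w e i j ≡ + (2 ℕ.^ j) * (sgn (i ∸ j) * + bin (e ∸ j) (i ∸ j))
  w-≤ e i j j≤i = begin
    w e i j
      ≡⟨ coeff-pmul (ppow 2x j) (ppow 1-x (e ∸ j)) i ⟩
    Σℤ (suc i) (λ a → coeff (ppow 2x j) a * coeff (ppow 1-x (e ∸ j)) (i ∸ a))
      ≡⟨ Σ-delta (suc i) j _ (s≤s j≤i) (λ a _ a≢j → trans (cong (_* coeff (ppow 1-x (e ∸ j)) (i ∸ a)) (coeff-2x^-off j a (λ j≡a → a≢j (sym j≡a))))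
                                                         (ℤP.*-zeroˡ (coeff (ppow 1-x (e ∸ j)) (i ∸ a)))) ⟩
    coeff (ppow 2x j) j * coeff (ppow 1-x (e ∸ j)) (i ∸ j)
      ≡⟨ cong₂ _*_ (coeff-2x^-diagonal j) (coeff-1-x^ (e ∸ j) (i ∸ j)) ⟩
    + (2 ℕ.^ j) * (sgn (i ∸ j) * + bin (e ∸ j) (i ∸ j)) ∎

  w-> : ∀ e i j → i < j → w e i j ≡ + 0
  w-> e i j i<j = trans (coeff-pmul (ppow 2x j) (ppow 1-x (e ∸ j)) i) (Σ-zero (suc i) _ vanish)
    where
    vanish : ∀ a → a < suc i → coeff (ppow 2x j) a * coeff (ppow 1-x (e ∸ j)) (i ∸ a) ≡ + 0
    vanish a a<1+i = trans (cong (_* coeff (ppow 1-x (e ∸ j)) (i ∸ a))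
      (coeff-2x^-off j a (λ j≡a → ℕP.<-irrefl (sym j≡a) (ℕP.≤-<-trans (ℕP.≤-pred a<1+i) i<j))))
                           (ℤP.*-zeroˡ (coeff (ppow 1-x (e ∸ j)) (i ∸ a)))

  coeff-hsc : ∀ R e i → coeff (hsc R e) i ≡ Σℤ (suc e) (λ j → + fvec R j * w e i j)
  coeff-hsc R e i = trans (coeff-sum (suc e) (λ j → pscale (+ fvec R j) (pmul (ppow 2x j) (ppow 1-x (e ∸ j)))) (λ j → j) i)
    (Σ-cong≡ (suc e) (λ j → coeff-pscale (+ fvec R j) (pmul (ppow 2x j) (ppow 1-x (e ∸ j))) i))

  coeff-limit : ∀ R e i → coeff (limitPoly R e) i ≡ + fvec R e * + bin e i
  coeff-limit R e i = trans (coeff-pscale (+ fvec R e) (ppow 1+x e) i) (cong (+ fvec R e *_) (coeff-1+x^ e i))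

  -- C(e,j) w(e,i,j) = C(e,i) C(i,j) 2^j (-1)^(i-j),  using C(e,j) C(e-j,i-j) = C(e,i) C(i,j)
  top-row-term : ∀ e i j → j ≤ i → + bin e j * w e i j ≡ + bin e i * (+ bin i j * (+ (2 ℕ.^ j) * sgn (i ∸ j)))
  top-row-term e i j j≤i = begin
    + bin e j * w e i j
      ≡⟨ cong (+ bin e j *_) (w-≤ e i j j≤i) ⟩
    + bin e j * (+ (2 ℕ.^ j) * (sgn (i ∸ j) * + bin (e ∸ j) (i ∸ j)))
      ≡⟨ regroup₁ (+ bin e j) (+ bin (e ∸ j) (i ∸ j)) (+ (2 ℕ.^ j)) (sgn (i ∸ j)) ⟩
    (+ bin e j * + bin (e ∸ j) (i ∸ j)) * (+ (2 ℕ.^ j) * sgn (i ∸ j))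
      ≡⟨ cong (_* (+ (2 ℕ.^ j) * sgn (i ∸ j))) choose ⟩
    (+ bin e i * + bin i j) * (+ (2 ℕ.^ j) * sgn (i ∸ j))
      ≡⟨ ℤP.*-assoc (+ bin e i) _ _ ⟩
    + bin e i * (+ bin i j * (+ (2 ℕ.^ j) * sgn (i ∸ j))) ∎
    where
    regroup₁ : ∀ a d p s → a * (p * (s * d)) ≡ (a * d) * (p * s)
    regroup₁ = solve-∀
    choose : + bin e j * + bin (e ∸ j) (i ∸ j) ≡ + bin e i * + bin i j
    choose = trans (sym (ℤP.pos-* (bin e j) _)) (trans (cong +_ (trans (sym (trinomial e j (i ∸ j)))
      (cong (λ z → bin e z ℕ.* bin z j) (ℕP.m+[n∸m]≡n j≤i)))) (ℤP.pos-* (bin e i) (bin i j)))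

  -- Σ_j C(e,j) w(e,i,j) = [x^i] (2x + 1 - x)^e = C(e,i)
  top-row : ∀ e i → Σℤ (suc e) (λ j → + bin e j * w e i j) ≡ + bin e i
  top-row e i with i ℕP.≤? e
  ... | yes i≤e = begin
    Σℤ (suc e) (λ j → + bin e j * w e i j)
      ≡⟨ Σ-extend (suc i) (suc e) _ (s≤s i≤e) (λ j i<j _ → trans (cong (+ bin e j *_) (w-> e i j i<j)) (ℤP.*-zeroʳ (+ bin e j))) ⟩
    Σℤ (suc i) (λ j → + bin e j * w e i j)
      ≡⟨ Σ-cong (suc i) (λ j j<1+i → top-row-term e i j (ℕP.≤-pred j<1+i)) ⟩
    Σℤ (suc i) (λ j → + bin e i * (+ bin i j * (+ (2 ℕ.^ j) * sgn (i ∸ j))))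
      ≡⟨ Σ-*ˡ (suc i) (+ bin e i) _ ⟨
    + bin e i * Σℤ (suc i) (λ j → + bin i j * (+ (2 ℕ.^ j) * sgn (i ∸ j)))
      ≡⟨ cong (+ bin e i *_) (alternating-sum i) ⟩
    + bin e i * + 1
      ≡⟨ ℤP.*-identityʳ _ ⟩
    + bin e i ∎
  ... | no i≰e = trans (Σ-zero (suc e) _ vanish) (sym (cong +_ (bin-> e i (ℕP.≰⇒> i≰e))))
    where
    vanish : ∀ j → j < suc e → + bin e j * w e i j ≡ + 0
    vanish j j<1+e = trans (cong (+ bin e j *_) (trans (w-≤ e i j j≤i)
        (trans (cong (λ b → + (2 ℕ.^ j) * (sgn (i ∸ j) * + b)) (bin-> (e ∸ j) (i ∸ j) e∸j<i∸j))
        (trans (cong (+ (2 ℕ.^ j) *_) (ℤP.*-zeroʳ (sgn (i ∸ j)))) (ℤP.*-zeroʳ (+ (2 ℕ.^ j)))))))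
      (ℤP.*-zeroʳ (+ bin e j))
      where
      j≤i : j ≤ i
      j≤i = ℕP.≤-trans (ℕP.≤-pred j<1+e) (ℕP.<⇒≤ (ℕP.≰⇒> i≰e))
      e∸j<i∸j : e ∸ j < i ∸ j
      e∸j<i∸j = ℕP.∸-monoˡ-< (ℕP.≰⇒> i≰e) (ℕP.≤-pred j<1+e)

-- If f-vectors evolve by  f_j(S (n+1)) = Σ_i f_i(S n) C(i,j) 2^j,
-- expanding f(S 0) in the eigenbasis given by the rows of Pascal's matrix,
--   f_j(S 0) = Σ_k c_k C(k,j),  c_k = Σ_i f_i(S 0) C(i,k) (-1)^(i-k),
-- gives  f_j(S n) = Σ_k c_k 2^(nk) C(k,j), and hence every coefficient of
-- h^(sc)(S n) is an exponential sum Σ_{k ≤ e} α_k 2^(nk) with α_e = f_e(S 0) C(e,i).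

module ClosedForm (e : ℕ) (S : ℕ → FaceRel)
  (recurrence : ∀ n j → fvec (S (ℕ.suc n)) j ≡ Binomial.Σℕ (ℕ.suc e) (λ i → fvec (S n) i ℕ.* (Binomial.bin i j ℕ.* 2 ℕ.^ j)))
  where

  open import Data.Nat as ℕ using (ℕ; zero; suc; _∸_; _≤_; _<_; s≤s; _^_)
  import Data.Nat.Properties as ℕP
  open import Data.Integer as ℤ using (ℤ; +_; _+_; _*_)
  import Data.Integer.Properties as ℤP
  open import Relation.Binary.PropositionalEquality as ≡ using (_≡_; _≢_; refl; sym; trans; cong; cong₂)
  open import Data.Integer.Tactic.RingSolver using (solve-∀)
  open Binomial using (bin; bin->; bin-nn; Σℕ)
  open BinomialSums using (pascal-eigenvector)
  open Polynomials using (Σℤ; Σ-cong; Σ-cong≡; Σ-*ˡ; Σ-*ʳ; Σ-swap; Σ-delta; sgn)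
  open SignedBinomialSums using (pascal-inverse-diagonal; pascal-inverse-off)
  open HPolynomial using (w; coeff-hsc; top-row)
  open ≡.≡-Reasoning

  f : ℕ → ℕ → ℕ
  f n j = fvec (S n) j

  Σℕ→Σℤ : ∀ m (g : ℕ → ℕ) → + (Σℕ m g) ≡ Σℤ m (λ i → + g i)
  Σℕ→Σℤ zero    g = refl
  Σℕ→Σℤ (suc m) g = trans (ℤP.pos-+ (Σℕ m g) (g m)) (cong (_+ + g m) (Σℕ→Σℤ m g))

  coord : ℕ → ℤ
  coord k = Σℤ (suc e) (λ i → + f 0 i * (+ bin i k * sgn (i ∸ k)))

  expansion : ∀ j → j ≤ e → + f 0 j ≡ Σℤ (suc e) (λ k → coord k * + bin k j)
  expansion j j≤e = sym (begin
    Σℤ (suc e) (λ k → coord k * + bin k j)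
      ≡⟨ Σ-cong≡ (suc e) (λ k → Σ-*ʳ (suc e) (+ bin k j) (λ i → + f 0 i * (+ bin i k * sgn (i ∸ k)))) ⟩
    Σℤ (suc e) (λ k → Σℤ (suc e) (λ i → (+ f 0 i * (+ bin i k * sgn (i ∸ k))) * + bin k j))
      ≡⟨ Σ-swap (suc e) (suc e) (λ k i → (+ f 0 i * (+ bin i k * sgn (i ∸ k))) * + bin k j) ⟩
    Σℤ (suc e) (λ i → Σℤ (suc e) (λ k → (+ f 0 i * (+ bin i k * sgn (i ∸ k))) * + bin k j))
      ≡⟨ Σ-cong≡ (suc e) (λ i → trans (Σ-cong≡ (suc e) (λ k → ℤP.*-assoc (+ f 0 i) _ _)) (sym (Σ-*ˡ (suc e) (+ f 0 i) _))) ⟩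
    Σℤ (suc e) (λ i → + f 0 i * SignedBinomialSums.pascal-inverse e i j)
      ≡⟨ Σ-delta (suc e) j _ (s≤s j≤e) (λ i i<1+e i≢j → trans (cong (+ f 0 i *_) (pascal-inverse-off e i j (ℕP.≤-pred i<1+e) i≢j))
           (ℤP.*-zeroʳ (+ f 0 i))) ⟩
    + f 0 j * SignedBinomialSums.pascal-inverse e j j
      ≡⟨ cong (+ f 0 j *_) (pascal-inverse-diagonal e j j≤e) ⟩
    + f 0 j * + 1
      ≡⟨ ℤP.*-identityʳ _ ⟩
    + f 0 j ∎)

  -- the top coordinate is f_e(S 0) (Pascal's matrix is unitriangular)
  coord-top : coord e ≡ + f 0 e
  coord-top = trans (Σ-delta (suc e) e _ ℕP.≤-refl below-top)
    (trans (cong₂ (λ c s → + f 0 e * (+ c * sgn s)) (bin-nn e) (ℕP.n∸n≡0 e)) (ℤP.*-identityʳ _))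
    where
    below-top : ∀ i → i < suc e → i ≢ e → + f 0 i * (+ bin i e * sgn (i ∸ e)) ≡ + 0
    below-top i i<1+e i≢e = trans (cong (λ t → + f 0 i * (+ t * sgn (i ∸ e))) (bin-> i e (ℕP.≤∧≢⇒< (ℕP.≤-pred i<1+e) i≢e)))
      (ℤP.*-zeroʳ (+ f 0 i))

  closed-form : ∀ n j → j ≤ e → + f n j ≡ Σℤ (suc e) (λ k → coord k * (+ (2 ^ (n ℕ.* k)) * + bin k j))
  closed-form zero    j j≤e = trans (expansion j j≤e) (Σ-cong≡ (suc e) (λ k → cong (coord k *_) (sym (ℤP.*-identityˡ (+ bin k j)))))
  closed-form (suc n) j j≤e = begin
    + f (suc n) j
      ≡⟨ cong +_ (recurrence n j) ⟩
    + Σℕ (suc e) (λ i → f n i ℕ.* (bin i j ℕ.* 2 ^ j))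
      ≡⟨ Σℕ→Σℤ (suc e) _ ⟩
    Σℤ (suc e) (λ i → + (f n i ℕ.* (bin i j ℕ.* 2 ^ j)))
      ≡⟨ Σ-cong (suc e) (λ i i<1+e → trans (ℤP.pos-* (f n i) _) (cong (_* + (bin i j ℕ.* 2 ^ j)) (closed-form n i (ℕP.≤-pred i<1+e)))) ⟩
    Σℤ (suc e) (λ i → Σℤ (suc e) (λ k → coord k * (P k * + bin k i)) * + (bin i j ℕ.* 2 ^ j))
      ≡⟨ Σ-cong≡ (suc e) (λ i → Σ-*ʳ (suc e) (+ (bin i j ℕ.* 2 ^ j)) (λ k → coord k * (P k * + bin k i))) ⟩
    Σℤ (suc e) (λ i → Σℤ (suc e) (λ k → coord k * (P k * + bin k i) * + (bin i j ℕ.* 2 ^ j)))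
      ≡⟨ Σ-swap (suc e) (suc e) (λ i k → coord k * (P k * + bin k i) * + (bin i j ℕ.* 2 ^ j)) ⟩
    Σℤ (suc e) (λ k → Σℤ (suc e) (λ i → coord k * (P k * + bin k i) * + (bin i j ℕ.* 2 ^ j)))
      ≡⟨ Σ-cong≡ (suc e) (λ k → trans (Σ-cong≡ (suc e) (λ i → pull-out k i)) (sym (Σ-*ˡ (suc e) (coord k * P k) _))) ⟩
    Σℤ (suc e) (λ k → (coord k * P k) * Σℤ (suc e) (λ i → + (bin k i ℕ.* (bin i j ℕ.* 2 ^ j))))
      ≡⟨ Σ-cong (suc e) (λ k k<1+e → cong ((coord k * P k) *_) (trans (sym (Σℕ→Σℤ (suc e) _))
           (cong +_ (pascal-eigenvector e k j (ℕP.≤-pred k<1+e))))) ⟩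
    Σℤ (suc e) (λ k → (coord k * P k) * + (bin k j ℕ.* 2 ^ k))
      ≡⟨ Σ-cong≡ (suc e) eigenvalue ⟩
    Σℤ (suc e) (λ k → coord k * (+ (2 ^ (suc n ℕ.* k)) * + bin k j)) ∎
    where
    P : ℕ → ℤ
    P k = + (2 ^ (n ℕ.* k))
    pull-out : ∀ k i → coord k * (P k * + bin k i) * + (bin i j ℕ.* 2 ^ j) ≡ (coord k * P k) * + (bin k i ℕ.* (bin i j ℕ.* 2 ^ j))
    pull-out k i = trans (regroup (coord k) (P k) (+ bin k i) (+ (bin i j ℕ.* 2 ^ j))) (cong ((coord k * P k) *_) (sym (ℤP.pos-* (bin k i) _)))
      where
      regroup : ∀ x p c d → x * (p * c) * d ≡ (x * p) * (c * d)
      regroup = solve-∀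
    eigenvalue : ∀ k → (coord k * P k) * + (bin k j ℕ.* 2 ^ k) ≡ coord k * (+ (2 ^ (suc n ℕ.* k)) * + bin k j)
    eigenvalue k = begin
      (coord k * P k) * + (bin k j ℕ.* 2 ^ k)     ≡⟨ cong ((coord k * P k) *_) (ℤP.pos-* (bin k j) (2 ^ k)) ⟩
      (coord k * P k) * (+ bin k j * + (2 ^ k))   ≡⟨ regroup (coord k) (P k) (+ bin k j) (+ (2 ^ k)) ⟩
      coord k * ((+ (2 ^ k) * P k) * + bin k j)   ≡⟨ cong (λ z → coord k * (z * + bin k j))
        (trans (sym (ℤP.pos-* (2 ^ k) _)) (cong +_ (sym (ℕP.^-distribˡ-+-* 2 k (n ℕ.* k))))) ⟩
      coord k * (+ (2 ^ (suc n ℕ.* k)) * + bin k j) ∎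
      where
      regroup : ∀ x p c t → (x * p) * (c * t) ≡ x * ((t * p) * c)
      regroup = solve-∀

  -- the coefficient of 2^(nk) in [x^i] h^(sc)(S n)
  α : ℕ → ℕ → ℤ
  α i k = coord k * Σℤ (suc e) (λ j → + bin k j * w e i j)

  α-top : ∀ i → α i e ≡ + f 0 e * + bin e i
  α-top i = cong₂ _*_ coord-top (top-row e i)

  coeff-hsc-closed : ∀ n i → coeff (hsc (S n) e) i ≡ Σℤ (suc e) (λ k → α i k * + (2 ^ (n ℕ.* k)))
  coeff-hsc-closed n i = begin
    coeff (hsc (S n) e) i
      ≡⟨ coeff-hsc (S n) e i ⟩
    Σℤ (suc e) (λ j → + f n j * w e i j)
      ≡⟨ Σ-cong (suc e) (λ j j<1+e → cong (_* w e i j) (closed-form n j (ℕP.≤-pred j<1+e))) ⟩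
    Σℤ (suc e) (λ j → Σℤ (suc e) (λ k → coord k * (P k * + bin k j)) * w e i j)
      ≡⟨ Σ-cong≡ (suc e) (λ j → Σ-*ʳ (suc e) (w e i j) (λ k → coord k * (P k * + bin k j))) ⟩
    Σℤ (suc e) (λ j → Σℤ (suc e) (λ k → coord k * (P k * + bin k j) * w e i j))
      ≡⟨ Σ-swap (suc e) (suc e) (λ j k → coord k * (P k * + bin k j) * w e i j) ⟩
    Σℤ (suc e) (λ k → Σℤ (suc e) (λ j → coord k * (P k * + bin k j) * w e i j))
      ≡⟨ Σ-cong≡ (suc e) (λ k → trans (Σ-cong≡ (suc e) (λ j → regroup₁ (coord k) (P k) (+ bin k j) (w e i j)))
                                   (trans (sym (Σ-*ˡ (suc e) (coord k * P k) _)) (regroup₂ (coord k) (P k) _))) ⟩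
    Σℤ (suc e) (λ k → α i k * P k) ∎
    where
    P : ℕ → ℤ
    P k = + (2 ^ (n ℕ.* k))
    regroup₁ : ∀ x p c v → x * (p * c) * v ≡ (x * p) * (c * v)
    regroup₁ = solve-∀
    regroup₂ : ∀ x p s → (x * p) * s ≡ (x * s) * p
    regroup₂ = solve-∀

module NatSums where

  open import Data.Nat using (zero; suc; _≤_; _<_; z≤n)
  import Data.Nat.Properties as ℕP
  open import Relation.Binary.PropositionalEquality using (refl)
  open import Relation.Nullary using (yes; no)
  open Binomial using (Σℕ)

  Σ-mono : ∀ m (f g : ℕ → ℕ) → (∀ k → k < m → f k ≤ g k) → Σℕ m f ≤ Σℕ m g
  Σ-mono zero    f g h = z≤n
  Σ-mono (suc m) f g h = ℕP.+-mono-≤ (Σ-mono m f g (λ k k<m → h k (ℕP.m<n⇒m<1+n k<m))) (h m ℕP.≤-refl)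

  term≤Σ : ∀ m (g : ℕ → ℕ) k → k < m → g k ≤ Σℕ m g
  term≤Σ (suc m) g k k<1+m with k ℕP.≟ m
  ... | yes refl = ℕP.m≤n+m (g k) (Σℕ m g)
  ... | no k≢m   = ℕP.≤-trans (term≤Σ m g k (ℕP.≤∧≢⇒< (ℕP.≤-pred k<1+m) k≢m)) (ℕP.m≤m+n (Σℕ m g) (g m))

-- Exponential sums  c n = Σ_{k ≤ e} α_k 2^(nk)  are dominated by their leading
-- term:  |c n - α_e 2^(ne)| 2^n ≤ B 2^(ne)  with  B = Σ_{k < e} |α_k|.  Hence
-- c n / 2^(ne) → α_e in ℚ.

module ExponentialSums (e : ℕ) (α : ℕ → ℤ) where

  open import Data.Nat as ℕ using (zero; suc; _≤_; _<_; z≤n; _^_)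
  import Data.Nat.Properties as ℕP
  open import Data.Integer as ℤ using (ℤ; +_; -[1+_]; _+_; _*_; _-_; ∣_∣; +<+)
  import Data.Integer.Properties as ℤP
  open import Data.Rational as ℚ using (ℚ; mkℚ; 0ℚ; ↥_; ↧_; toℚᵘ)
  import Data.Rational.Properties as ℚP
  import Data.Rational.Unnormalised as ℚᵘ
  import Data.Rational.Unnormalised.Properties as ℚᵘP
  open import Relation.Binary.PropositionalEquality as ≡ using (_≡_; refl; sym; trans; cong; subst; subst₂)
  open import Data.Product using (_,_; ∃)
  open import Data.Integer.Tactic.RingSolver using (solve-∀)
  import Data.Nat.Tactic.RingSolver as ℕSolver
  open Binomial using (Σℕ)
  open NatSums using (Σ-mono)
  open Polynomials using (Σℤ)
  open CubicalRank using (n<2^n)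
  module Σᴺ = FiniteSums ℕP.+-*-commutativeSemiring

  c : ℕ → ℤ
  c n = Σℤ (suc e) (λ k → α k * + (2 ^ (n ℕ.* k)))

  B : ℕ
  B = Σℕ e (λ k → ∣ α k ∣)

  D : ℕ → ℕ
  D n = 2 ^ (n ℕ.* e)

  error : ℕ → ℤ
  error n = c n - α e * + D n

  triangle : ∀ m (g : ℕ → ℤ) → ∣ Σℤ m g ∣ ≤ Σℕ m (λ k → ∣ g k ∣)
  triangle zero    g = z≤n
  triangle (suc m) g = ℕP.≤-trans (ℤP.∣i+j∣≤∣i∣+∣j∣ (Σℤ m g) (g m)) (ℕP.+-monoˡ-≤ ∣ g m ∣ (triangle m g))

  error≡ : ∀ n → error n ≡ Σℤ e (λ k → α k * + (2 ^ (n ℕ.* k)))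
  error≡ n = cancel (Σℤ e (λ k → α k * + (2 ^ (n ℕ.* k)))) (α e * + D n)
    where
    cancel : ∀ a b → a + b - b ≡ a
    cancel = solve-∀

  -- each lower term is at most |α_k| 2^(n(e-1)) ≤ |α_k| 2^(ne) / 2^n
  error-bound : ∀ n → ∣ error n ∣ ℕ.* 2 ^ n ≤ B ℕ.* D n
  error-bound n = begin
    ∣ error n ∣ ℕ.* 2 ^ n                                 ≡⟨ cong (λ x → ∣ x ∣ ℕ.* 2 ^ n) (error≡ n) ⟩
    ∣ Σℤ e (λ k → α k * + (2 ^ (n ℕ.* k))) ∣ ℕ.* 2 ^ n   ≤⟨ ℕP.*-monoˡ-≤ (2 ^ n) (triangle e _) ⟩
    Σℕ e (λ k → ∣ α k * + (2 ^ (n ℕ.* k)) ∣) ℕ.* 2 ^ n   ≡⟨ Σᴺ.Σ-*ʳ e (2 ^ n) _ ⟩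
    Σℕ e (λ k → ∣ α k * + (2 ^ (n ℕ.* k)) ∣ ℕ.* 2 ^ n)   ≤⟨ Σ-mono e _ _ lower-term ⟩
    Σℕ e (λ k → ∣ α k ∣ ℕ.* D n)                         ≡⟨ Σᴺ.Σ-*ʳ e (D n) _ ⟨
    B ℕ.* D n                                            ∎
    where
    open ℕP.≤-Reasoning
    lower-term : ∀ k → k < e → ∣ α k * + (2 ^ (n ℕ.* k)) ∣ ℕ.* 2 ^ n ≤ ∣ α k ∣ ℕ.* D n
    lower-term k k<e = begin
      ∣ α k * + (2 ^ (n ℕ.* k)) ∣ ℕ.* 2 ^ n     ≡⟨ cong (ℕ._* 2 ^ n) (ℤP.abs-* (α k) (+ (2 ^ (n ℕ.* k)))) ⟩
      ∣ α k ∣ ℕ.* 2 ^ (n ℕ.* k) ℕ.* 2 ^ n       ≡⟨ ℕP.*-assoc ∣ α k ∣ _ _ ⟩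
      ∣ α k ∣ ℕ.* (2 ^ (n ℕ.* k) ℕ.* 2 ^ n)     ≡⟨ cong (∣ α k ∣ ℕ.*_) (ℕP.^-distribˡ-+-* 2 (n ℕ.* k) n) ⟨
      ∣ α k ∣ ℕ.* 2 ^ (n ℕ.* k ℕ.+ n)           ≡⟨ cong (λ m → ∣ α k ∣ ℕ.* 2 ^ m) (trans (ℕP.+-comm (n ℕ.* k) n) (sym (ℕP.*-suc n k))) ⟩
      ∣ α k ∣ ℕ.* 2 ^ (n ℕ.* suc k)             ≤⟨ ℕP.*-monoʳ-≤ ∣ α k ∣ (ℕP.^-monoʳ-≤ 2 (ℕP.*-monoʳ-≤ n k<e)) ⟩
      ∣ α k ∣ ℕ.* D n                           ∎

  error-small : ∀ M n → M ℕ.* B ≤ n → ∣ error n ∣ ℕ.* M < D n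
  error-small M n MB≤n = ℕP.*-cancelʳ-< (2 ^ n) _ _ (begin-strict
    ∣ error n ∣ ℕ.* M ℕ.* 2 ^ n       ≡⟨ regroup₁ ∣ error n ∣ M (2 ^ n) ⟩
    M ℕ.* (∣ error n ∣ ℕ.* 2 ^ n)     ≤⟨ ℕP.*-monoʳ-≤ M (error-bound n) ⟩
    M ℕ.* (B ℕ.* D n)                 ≡⟨ ℕP.*-assoc M B (D n) ⟨
    M ℕ.* B ℕ.* D n                   <⟨ ℕP.*-monoˡ-< (D n) (ℕP.≤-<-trans MB≤n (n<2^n n)) ⟩
    2 ^ n ℕ.* D n                     ≡⟨ ℕP.*-comm (2 ^ n) (D n) ⟩
    D n ℕ.* 2 ^ n                     ∎)
    where
    open ℕP.≤-Reasoning
    instance _ = ℕP.m^n≢0 2 (n ℕ.* e)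
    regroup₁ : ∀ x m t → x ℕ.* m ℕ.* t ≡ m ℕ.* (x ℕ.* t)
    regroup₁ = ℕSolver.solve-∀

  rational-approximation : ∀ (z w : ℤ) (D : ℕ) .{{_ : ℕ.NonZero D}} (ε : ℚ) →
     (+ ∣ z - w * + D ∣) * ↧ ε ℤ.< ↥ ε * + D → ℚ.∣ (z ℚ./ D) ℚ.- (w ℚ./ 1) ∣ ℚ.< ε
  rational-approximation z w (suc D′) ε@(mkℚ p q _) h =
    ℚP.toℚᵘ-cancel-< (subst (ℚᵘ._< toℚᵘ ε) (sym (abs-toℚᵘ X)) (ℚᵘP.<-respˡ-≃ (ℚᵘP.∣-∣-cong (ℚᵘP.≃-sym X≃Y)) |Y|<ε))
    where
    abs-toℚᵘ : ∀ x → toℚᵘ (ℚ.∣ x ∣) ≡ ℚᵘ.∣ toℚᵘ x ∣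
    abs-toℚᵘ (mkℚ _ _ _) = refl
    X = (z ℚ./ suc D′) ℚ.- (w ℚ./ 1)
    Y : ℚᵘ.ℚᵘ
    Y = ℚᵘ.mkℚᵘ z D′ ℚᵘ.+ (ℚᵘ.- ℚᵘ.mkℚᵘ w 0)
    X≃Y : toℚᵘ X ℚᵘ.≃ Y
    X≃Y = ℚᵘP.≃-trans (ℚP.toℚᵘ-homo-+ (z ℚ./ suc D′) (ℚ.- (w ℚ./ 1)))
            (ℚᵘP.+-cong (ℚP.toℚᵘ-fromℚᵘ (ℚᵘ.mkℚᵘ z D′))
               (ℚᵘP.≃-trans (ℚP.toℚᵘ-homo‿- (w ℚ./ 1)) (ℚᵘP.-‿cong (ℚP.toℚᵘ-fromℚᵘ (ℚᵘ.mkℚᵘ w 0)))))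
    numerator : z * + 1 + (ℤ.- w) * + suc D′ ≡ z - w * + suc D′
    numerator = normalise z w (+ suc D′)
      where
      normalise : ∀ a b c → a * + 1 + (ℤ.- b) * c ≡ a - b * c
      normalise = solve-∀
    |Y|<ε : ℚᵘ.∣ Y ∣ ℚᵘ.< toℚᵘ ε
    |Y|<ε = ℚᵘ.*<* (subst (λ d → (+ ∣ z * + 1 + (ℤ.- w) * + suc D′ ∣) * + suc q ℤ.< p * + suc d) (sym (ℕP.*-identityʳ D′))
                     (subst (λ x → (+ ∣ x ∣) * + suc q ℤ.< p * + suc D′) (sym numerator) h))

  converges : ∀ ε → 0ℚ ℚ.< ε → ∃ λ N → ∀ n → N ≤ n → ℚ.∣ (c n /2^ (n ℕ.* e)) ℚ.- (α e /2^ 0) ∣ ℚ.< ε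
  converges ε@(mkℚ (+ suc p) q _) _ = suc q ℕ.* B , λ n N≤n →
    rational-approximation (c n) (α e) (D n) {{ℕP.m^n≢0 2 (n ℕ.* e)}} ε (integer-bound n N≤n)
    where
    integer-bound : ∀ n → suc q ℕ.* B ≤ n → (+ ∣ c n - α e * + D n ∣) * + suc q ℤ.< + suc p * + D n
    integer-bound n N≤n = subst₂ ℤ._<_ (ℤP.pos-* ∣ error n ∣ (suc q)) (ℤP.pos-* (suc p) (D n))
      (+<+ (ℕP.<-≤-trans (error-small (suc q) n N≤n) (ℕP.m≤n*m (D n) (suc p))))
  converges (mkℚ (+ zero) _ _)   (ℚ.*<* (+<+ ()))
  converges (mkℚ -[1+ _ ] _ _) (ℚ.*<* ())

-- Positivity and unimodality survive approximation: if |c_i - L_i D| < D/2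
-- for all i ≤ e, then c inherits positivity from L ≥ 1 and every strict
-- comparison between L_i and L_j.

module Unimodality where

  open import Data.Nat as ℕ using (zero; suc; _≤_; _<_; z≤n; s≤s; _∸_)
  import Data.Nat.Properties as ℕP
  open import Data.Integer as ℤ using (+_; -[1+_]; _+_; _-_; ∣_∣; +<+)
  import Data.Integer.Properties as ℤP
  open import Relation.Binary.PropositionalEquality as ≡ using (_≡_; refl; sym; trans; cong; subst; subst₂)
  open import Data.Product using (_,_; _×_; ∃; proj₁; proj₂)
  open import Data.Sum using (inj₁; inj₂)
  open import Relation.Nullary using (yes; no)
  open import Data.Empty using (⊥-elim)
  open import Data.Integer.Tactic.RingSolver using (solve-∀)

  positive-perturbation : ∀ M x → ∣ x ∣ < M → + 0 ℤ.< + M + x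
  positive-perturbation M (+ m)    |x|<M = +<+ (ℕP.<-≤-trans (ℕP.≤-<-trans z≤n |x|<M) (ℕP.m≤m+n M m))
  positive-perturbation M -[1+ m ] |x|<M = subst (+ 0 ℤ.<_) (sym (ℤP.⊖-≥ (ℕP.<⇒≤ |x|<M))) (+<+ (ℕP.m<n⇒0<n∸m |x|<M))

  <-perturbation : ∀ a b M x → b ≡ a + (+ M + x) → ∣ x ∣ < M → a ℤ.< b
  <-perturbation a b M x b≡ |x|<M = subst₂ ℤ._<_ (ℤP.+-identityʳ a) (sym b≡) (ℤP.+-monoʳ-< a (positive-perturbation M x |x|<M))

  module _ (c : ℕ → ℤ) (L : ℕ → ℕ) (D : ℕ) where

    error : ℕ → ℤ
    error i = c i - + (L i ℕ.* D)

    Close : ℕ → Set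
    Close i = ∣ error i ∣ ℕ.+ ∣ error i ∣ < D

    close-positive : ∀ i → 1 ≤ L i → Close i → + 0 ℤ.< c i
    close-positive i 1≤Li close = <-perturbation (+ 0) (c i) (L i ℕ.* D) (error i) (split (c i) (+ (L i ℕ.* D)))
      (ℕP.≤-<-trans (ℕP.m≤m+n ∣ error i ∣ ∣ error i ∣) (ℕP.<-≤-trans close (ℕP.m≤n*m D (L i) {{ℕ.>-nonZero 1≤Li}})))
      where
      split : ∀ x y → x ≡ + 0 + (y + (x - y))
      split = solve-∀

    close-ordered : ∀ i j → L i < L j → Close i → Close j → c i ℤ.≤ c j
    close-ordered i j Li<Lj close-i close-j = ℤP.<⇒≤ (<-perturbation (c i) (c j) ((L j ∸ L i) ℕ.* D) (error j - error i) difference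
      (ℕP.≤-<-trans (ℤP.∣i-j∣≤∣i∣+∣j∣ (error j) (error i)) (ℕP.<-≤-trans (halves {∣ error j ∣} {∣ error i ∣} close-j close-i)
        (ℕP.m≤n*m D (L j ∸ L i) {{ℕ.>-nonZero (ℕP.m<n⇒0<n∸m Li<Lj)}}))))
      where
      halves : ∀ {a b} → a ℕ.+ a < D → b ℕ.+ b < D → a ℕ.+ b < D
      halves {a} {b} a+a<D b+b<D with ℕP.≤-total a b
      ... | inj₁ a≤b = ℕP.≤-<-trans (ℕP.+-monoˡ-≤ b a≤b) b+b<D
      ... | inj₂ b≤a = ℕP.≤-<-trans (ℕP.+-monoʳ-≤ a b≤a) a+a<D
      gap : + ((L j ∸ L i) ℕ.* D) + + (L i ℕ.* D) ≡ + (L j ℕ.* D)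
      gap = trans (sym (ℤP.pos-+ ((L j ∸ L i) ℕ.* D) (L i ℕ.* D)))
              (cong +_ (trans (sym (ℕP.*-distribʳ-+ D (L j ∸ L i) (L i))) (cong (ℕ._* D) (ℕP.m∸n+n≡m (ℕP.<⇒≤ Li<Lj)))))
      difference : c j ≡ c i + (+ ((L j ∸ L i) ℕ.* D) + (error j - error i))
      difference = trans (expand (c i) (c j) (+ ((L j ∸ L i) ℕ.* D)) (+ (L i ℕ.* D)))
                     (cong (λ z → c i + (+ ((L j ∸ L i) ℕ.* D) + ((c j - z) - error i))) gap)
        where
        expand : ∀ ci cj u v → cj ≡ ci + (u + ((cj - (u + v)) - (ci - v)))
        expand = solve-∀

  unimodal-around : ∀ (c : ℕ → ℤ) e h → h ≤ e →
    (∀ i → i < h → c i ℤ.≤ c (suc i)) → (∀ i → suc h ≤ i → i < e → c (suc i) ℤ.≤ c i) →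
    ∃ λ k → k ≤ e × (∀ i → i < k → c i ℤ.≤ c (suc i)) × (∀ i → k ≤ i → i < e → c (suc i) ℤ.≤ c i)
  unimodal-around c e h h≤e up down with ℕP.m≤n⇒m<n∨m≡n h≤e
  ... | inj₂ refl = h , h≤e , up , λ i h≤i i<h → ⊥-elim (ℕP.<-irrefl refl (ℕP.≤-<-trans h≤i i<h))
  ... | inj₁ h<e with c h ℤP.≤? c (suc h)
  ...   | yes rises = suc h , h<e , up′ , down
    where
    up′ : ∀ i → i < suc h → c i ℤ.≤ c (suc i)
    up′ i i<1+h with ℕP.m≤n⇒m<n∨m≡n (ℕP.≤-pred i<1+h)
    ... | inj₁ i<h  = up i i<h
    ... | inj₂ refl = rises
  ...   | no falls = h , h≤e , up , down′
    where
    down′ : ∀ i → h ≤ i → i < e → c (suc i) ℤ.≤ c i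
    down′ i h≤i i<e with ℕP.m≤n⇒m<n∨m≡n h≤i
    ... | inj₁ h<i  = down i h<i i<e
    ... | inj₂ refl = ℤP.<⇒≤ (ℤP.≰⇒> falls)

  half : ∀ e → ∃ λ h → h ℕ.+ h ≤ e × e ≤ suc (h ℕ.+ h)
  half zero          = 0 , z≤n , z≤n
  half (suc zero)    = 0 , z≤n , s≤s z≤n
  half (suc (suc e)) with half e
  ... | h , 2h≤e , e≤2h+1 = suc h , subst (_≤ suc (suc e)) (sym (cong suc (ℕP.+-suc h h))) (s≤s (s≤s 2h≤e))
                              , subst (suc (suc e) ≤_) (sym (cong (λ z → suc (suc z)) (ℕP.+-suc h h))) (s≤s (s≤s e≤2h+1))

  approximately-unimodal : ∀ (p : Poly) e (L : ℕ → ℕ) D →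
    (∀ i → i ≤ e → 1 ≤ L i) →
    (∀ i → suc (suc (i ℕ.+ i)) ≤ e → L i < L (suc i)) →
    (∀ i → e ≤ i ℕ.+ i → i < e → L (suc i) < L i) →
    (∀ i → i ≤ e → Close (coeff p) L D i) →
    PositiveUnimodal p e
  approximately-unimodal p e L D positive increasing decreasing close =
    (λ i i≤e → close-positive (coeff p) L D i (positive i i≤e) (close i i≤e)) ,
    unimodal-around (coeff p) e h h≤e up down
    where
    h = proj₁ (half e)
    2h≤e = proj₁ (proj₂ (half e))
    e≤2h+1 = proj₂ (proj₂ (half e))
    h≤e : h ≤ e
    h≤e = ℕP.≤-trans (ℕP.m≤m+n h h) 2h≤e
    up : ∀ i → i < h → coeff p i ℤ.≤ coeff p (suc i)
    up i i<h = close-ordered (coeff p) L D i (suc i) (increasing i 2i+2≤e) (close i (ℕP.<⇒≤ i<e)) (close (suc i) i<e)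
      where
      2i+2≤e : suc (suc (i ℕ.+ i)) ≤ e
      2i+2≤e = ℕP.≤-trans (ℕP.≤-reflexive (cong suc (sym (ℕP.+-suc i i)))) (ℕP.≤-trans (ℕP.+-mono-≤ i<h i<h) 2h≤e)
      i<e : i < e
      i<e = ℕP.<-≤-trans (ℕP.m≤m+n (suc i) i) (ℕP.≤-trans (ℕP.n≤1+n _) 2i+2≤e)
    down : ∀ i → suc h ≤ i → i < e → coeff p (suc i) ℤ.≤ coeff p i
    down i h<i i<e = close-ordered (coeff p) L D (suc i) i (decreasing i e≤2i i<e) (close (suc i) i<e) (close i (ℕP.<⇒≤ i<e))
      where
      e≤2i : e ≤ i ℕ.+ i
      e≤2i = ℕP.≤-trans e≤2h+1 (ℕP.≤-trans (ℕP.m≤n+m (suc (h ℕ.+ h)) 1)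
               (ℕP.≤-trans (ℕP.≤-reflexive (cong suc (sym (ℕP.+-suc h h)))) (ℕP.+-mono-≤ h<i h<i)))

module IteratedSubdivision (e : ℕ) (K : FaceRel) (isComplex : IsCubicalComplex K) (hasDim : HasDim K e) where

  open import Data.Nat as ℕ using (zero; suc; _≤_; s≤s; _^_; _*_)
  import Data.Nat.Properties as ℕP
  open import Data.Integer as ℤ using (+_)
  import Data.Integer.Properties as ℤP
  open import Data.Rational using (ℚ; 0ℚ; _<_; _-_; ∣_∣)
  open import Data.List using (allFin)
  open import Data.List.Membership.Propositional.Properties using (∈-allFin)
  open import Relation.Binary.PropositionalEquality using (sym; trans; cong; cong₂; subst; subst₂)
  open import Data.Product using (Σ; ∃; _×_; _,_; proj₁; proj₂)
  open Binomial using (bin; Σℕ; bin-pos; bin-increasing; bin-decreasing)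
  open CubicalRank using (IsCubicalRank)

  S : ℕ → FaceRel
  S n = sdcIter n K

  BoundedRank : FaceRel → Set
  BoundedRank R = Σ (Fin (size R) → ℕ) λ r → IsCubicalRank R r × (∀ x → r x ≤ e)

  bounded-rank : ∀ n → BoundedRank (S n)
  bounded-rank zero = rank , isCubicalRank , λ x → subst (_≤ e) (CubicalRank.Properties.dim≡rank isCubicalRank x) (proj₂ hasDim x)
    where open CubicalComplexRank K isComplex using (rank; isCubicalRank)
  bounded-rank (suc n) with bounded-rank n
  ... | r , isRank , bounded = rank′ , isCubicalRank′ , rank′≤ e bounded
    where open SubdivisionRank isRank using (rank′; isCubicalRank′; rank′≤)

  recurrence : ∀ n j → fvec (S (suc n)) j ≡ Σℕ (suc e) (λ i → fvec (S n) i * (bin i j * 2 ^ j))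
  recurrence n j with bounded-rank n
  ... | r , isRank , bounded = SubdivisionRank.fvec-sdc isRank e bounded j

  open ClosedForm e S recurrence using (α; α-top; coeff-hsc-closed)

  top-faces : 1 ≤ fvec K e
  top-faces with proj₁ hasDim
  ... | x , dim≡e = Counting.cnt-pos _ (allFin (size K)) x (∈-allFin x) (ℕP.≡⇒≡ᵇ (dim K x) e dim≡e)

  limit : ℕ → ℕ
  limit i = fvec K e * bin e i

  α-top≡limit : ∀ i → α i e ≡ + limit i
  α-top≡limit i = trans (α-top i) (sym (ℤP.pos-* (fvec K e) (bin e i)))

  convergence : (i : ℕ) (ε : ℚ) → 0ℚ < ε → ∃ λ N → (n : ℕ) → N ≤ n →
    ∣ coeff (hsc (S n) e) i /2^ (n * e) - coeff (limitPoly K e) i /2^ 0 ∣ < ε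
  convergence i ε ε>0 with ExponentialSums.converges e (α i) ε ε>0
  ... | N , close = N , λ n N≤n → subst₂ (λ x y → ∣ x /2^ (n * e) - y /2^ 0 ∣ < ε)
          (sym (coeff-hsc-closed n i)) (sym (trans (HPolynomial.coeff-limit K e i) (sym (α-top i)))) (close n N≤n)

  threshold : ℕ
  threshold = 2 * Σℕ (suc e) (λ i → ExponentialSums.B e (α i))

  close : ∀ n → threshold ≤ n → ∀ i → i ≤ e → Unimodality.Close (coeff (hsc (S n) e)) limit (2 ^ (n * e)) i
  close n N≤n i i≤e = subst (ℕ._< 2 ^ (n * e)) doubled (ExponentialSums.error-small e (α i) 2 n (ℕP.≤-trans (ℕP.*-monoʳ-≤ 2 Bᵢ≤) N≤n))
    where
    Bᵢ≤ : ExponentialSums.B e (α i) ≤ Σℕ (suc e) (λ i → ExponentialSums.B e (α i))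
    Bᵢ≤ = NatSums.term≤Σ (suc e) (λ i → ExponentialSums.B e (α i)) i (s≤s i≤e)
    E = Unimodality.error (coeff (hsc (S n) e)) limit (2 ^ (n * e)) i
    error≡ : ExponentialSums.error e (α i) n ≡ E
    error≡ = cong₂ ℤ._-_ (sym (coeff-hsc-closed n i)) (trans (cong (ℤ._* + (2 ^ (n * e))) (α-top≡limit i)) (sym (ℤP.pos-* (limit i) _)))
    doubled : ℤ.∣ ExponentialSums.error e (α i) n ∣ * 2 ≡ ℤ.∣ E ∣ ℕ.+ ℤ.∣ E ∣
    doubled = trans (cong (λ x → ℤ.∣ x ∣ * 2) error≡) (trans (ℕP.*-comm ℤ.∣ E ∣ 2) (cong (ℤ.∣ E ∣ ℕ.+_) (ℕP.+-identityʳ ℤ.∣ E ∣)))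

  -- beyond the threshold the coefficients inherit positivity and unimodality from C(e, ·)
  eventually-unimodal : ∃ λ N → (n : ℕ) → N ≤ n → PositiveUnimodal (hsc (S n) e) e
  eventually-unimodal = threshold , λ n N≤n → Unimodality.approximately-unimodal (hsc (S n) e) e limit (2 ^ (n * e))
    (λ i i≤e → ℕP.*-mono-≤ top-faces (bin-pos e i i≤e))
    (λ i 2i+2≤e → ℕP.*-monoʳ-< (fvec K e) {{ℕ.>-nonZero top-faces}} (bin-increasing e i 2i+2≤e))
    (λ i e≤2i i<e → ℕP.*-monoʳ-< (fvec K e) {{ℕ.>-nonZero top-faces}} (bin-decreasing e i e≤2i i<e))
    (close n N≤n)

open import Data.Nat using (_≤_; _*_)
open import Data.Rational using (ℚ; 0ℚ; _<_; _-_; ∣_∣)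
open import Data.Product using (_×_; ∃; _,_)

corollary3p8 : (e : ℕ) (K : FaceRel) → IsCubicalComplex K → HasDim K e →
    ((i : ℕ) (ε : ℚ) → 0ℚ < ε → ∃ λ N → (n : ℕ) → N ≤ n →
    ∣ coeff (hsc (sdcIter n K) e) i /2^ (n * e) - coeff (limitPoly K e) i /2^ 0 ∣ < ε)
    × (∃ λ N → (n : ℕ) → N ≤ n → PositiveUnimodal (hsc (sdcIter n K) e) e)
corollary3p8 e K isComplex hasDim = convergence , eventually-unimodal
  where open IteratedSubdivision e K isComplex hasDim using (convergence; eventually-unimodal)
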